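{- Let $n\ge1$ and let $\alpha$ be a composition with at most $n$ parts. Then all the edge-labelled directed graphs $B(T_\alpha)_n$, for all partitions $\lambda$ and all standard tableaux $S$ of shape $\lambda$ with $DesComp(S)=\alpha$, are isomorphic as labelled directed graphs (i.e. via bijections preserving edges and their labels), no matter which crystal $B(\lambda)_n$ they live in.
   Context: Tableaux of shape $\lambda$: fillings of the Young diagram (English notation) by positive integers weakly increasing along rows, strictly increasing down columns; $SSYT(\lambda)_n$: those with entries $\le n$. Row reading word $rw(T)$: rows left to right, from bottom row to top row. Crystal operators on words over $\{1,\dots,n\}$, $1\le i\le n-1$: place ")" under each $i$ and "(" under each $i+1$, repeatedly delete a "(" immediately followed (among remaining symbols) by ")", leaving $)^{\varphi}(^{\varepsilon}$; $f_i$ changes the $i$ of the rightmost unmatched ")" into $i+1$ (undefined if $\varphi=0$). On tableaux: apply $f_i$ to $rw(T)$ and change the corresponding entry. $B(\lambda)_n$: directed graph on $SSYT(\lambda)_n$ with an edge $T\to T'$ labelled $i$ when $f_i(T)=T'$. Standardization $std(T)$ of $T$ of weight $\gamma$: replace entries $1$ left to right by $1,\dots,\gamma_1$, entries $2$ left to right by $\gamma_1+1,\dots,\gamma_1+\gamma_2$, etc. Descent of a standard $S$ with $m$ cells: $i$ with $i+1$ in a strictly lower row than $i$; with descents $d_1<\dots<d_k$, $DesComp(S)=(d_1,d_2-d_1,\dots,m-d_k)$. For standard $S$ with $DesComp(S)=\alpha$, $T_\alpha$ is obtained from $S$ by replacing entries $\alpha_1+\dots+\alpha_{r-1}+1,\dots,\alpha_1+\dots+\alpha_r$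 by $r$, and $B(T_\alpha)_n$ is the edge-labelled subgraph of $B(\lambda)_n$ induced on $\{T\in SSYT(\lambda)_n: std(T)=S\}$. -}

module Defs where

open import Data.Nat using (ℕ; zero; suc; _+_; _∸_; _≤_; _<_; _≥_; _≡ᵇ_; _<ᵇ_)
open import Data.Bool using (Bool; true; false; if_then_else_)
open import Data.Nat.ListAction using (sum)
open import Data.List using (List; []; _∷_; length; map; concat; reverse; take; drop; filterᵇ; applyUpTo; zip)
open import Data.List.Relation.Unary.All using (All)
open import Data.List.Relation.Unary.Linked using (Linked)
open import Data.List.Relation.Binary.Permutation.Propositional using (_↭_)
open import Data.Maybe using (Maybe; just; nothing)
open import Data.Product using (Σ; _×_; _,_; proj₁)
open import Data.Unit using (⊤)
open import Data.Empty using (⊥)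
open import Relation.Binary.PropositionalEquality using (_≡_)

IsPartition : List ℕ → Set
IsPartition λ' = All (λ k → 0 < k) λ' × Linked _≥_ λ'

IsComposition : List ℕ → Set
IsComposition α = All (λ k → 0 < k) α

-- Tableaux: a list of rows (top row first, English notation),
-- each row a list of entries read left to right.

Tableau : Set
Tableau = List (List ℕ)

shape : Tableau → List ℕ
shape T = map length T

RowWeak : List ℕ → Set
RowWeak r = Linked _≤_ r

ColStrict : List ℕ → List ℕ → Set
ColStrict _ [] = ⊤
ColStrict [] (_ ∷ _) = ⊥
ColStrict (a ∷ as) (b ∷ bs) = (a < b) × ColStrict as bs

ColsStrict : Tableau → Set
ColsStrict [] = ⊤
ColsStrict (r ∷ []) = ⊤
ColsStrict (r ∷ r' ∷ rs) = ColStrict r r' × ColsStrict (r' ∷ rs)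

SSYT : List ℕ → ℕ → Tableau → Set
SSYT λ' n T =
  shape T ≡ λ'
  × All (All (λ e → 1 ≤ e × e ≤ n)) T
  × All RowWeak T
  × ColsStrict T

Standard : List ℕ → Tableau → Set
Standard λ' S = SSYT λ' (sum λ') S × (concat S ↭ applyUpTo suc (sum λ'))

rw : Tableau → List ℕ
rw T = concat (reverse T)

cut : List ℕ → List ℕ → List (List ℕ)
cut [] _ = []
cut (k ∷ ks) w = take k w ∷ cut ks (drop k w)

fromRw : List ℕ → List ℕ → Tableau
fromRw λ' w = reverse (cut (reverse λ') w)

-- Scan left to right; k = number of currently unmatched "(" (letters i+1).
-- A letter i (")") is matched iff k > 0 (it cancels the nearest unmatched "(").
-- `acc` records the position of the rightmost unmatched ")" seen so far.

lastUnmatched : ℕ → ℕ → List ℕ → ℕ → Maybe ℕ → Maybe ℕ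
lastUnmatched i k [] pos acc = acc
lastUnmatched i k (x ∷ xs) pos acc =
  if x ≡ᵇ suc i then lastUnmatched i (suc k) xs (suc pos) acc
  else (if x ≡ᵇ i
        then (unm k)
        else lastUnmatched i k xs (suc pos) acc)
  where
    unm : ℕ → Maybe ℕ
    unm zero = lastUnmatched i zero xs (suc pos) (just pos)
    unm (suc k') = lastUnmatched i k' xs (suc pos) acc

setAt : List ℕ → ℕ → ℕ → List ℕ
setAt [] _ _ = []
setAt (x ∷ xs) zero v = v ∷ xs
setAt (x ∷ xs) (suc p) v = x ∷ setAt xs p v

fWord : ℕ → List ℕ → Maybe (List ℕ)
fWord i w with lastUnmatched i 0 w 0 nothing
... | nothing = nothing
... | just p = just (setAt w p (suc i))

fTab : ℕ → Tableau → Maybe Tableau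
fTab i T with fWord i (rw T)
... | nothing = nothing
... | just w = just (fromRw (shape T) w)

-- An entry v in column c (0-based) becomes
--   #{entries < v} + #{entries equal to v in columns < c} + 1,
-- i.e. entries v are renumbered left to right after all smaller entries.

count : ℕ → List ℕ → ℕ
count v r = length (filterᵇ (λ x → x ≡ᵇ v) r)

stdRow : Tableau → ℕ → List ℕ → List ℕ
stdRow T c [] = []
stdRow T c (v ∷ vs) =
  suc (length (filterᵇ (λ x → x <ᵇ v) (concat T)) + sum (map (λ row → count v (take c row)) T))
  ∷ stdRow T (suc c) vs

std : Tableau → Tableau
std T = map (stdRow T 0) T

memᵇ : ℕ → List ℕ → Bool
memᵇ x [] = false
memᵇ x (y ∷ ys) = if y ≡ᵇ x then true else memᵇ x ys

-- index (0 = top) of the row containing x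
rowOf : Tableau → ℕ → ℕ
rowOf [] x = 0
rowOf (r ∷ rs) x = if memᵇ x r then 0 else suc (rowOf rs x)

descents : Tableau → List ℕ
descents S = filterᵇ (λ i → rowOf S i <ᵇ rowOf S (suc i)) (applyUpTo suc (length (concat S) ∸ 1))

diffs : ℕ → List ℕ → ℕ → List ℕ
diffs prev [] m = (m ∸ prev) ∷ []
diffs prev (d ∷ ds) m = (d ∸ prev) ∷ diffs d ds m

DesComp : Tableau → List ℕ
DesComp S = diffs 0 (descents S) (length (concat S))

-- The graph B(T_α)_n for a standard tableau S of shape λ:
-- vertices are T ∈ SSYT(λ)_n with std(T) = S; an edge T → T' labelled i
-- (1 ≤ i ≤ n-1) when f_i(T) = T' (induced subgraph of B(λ)_n).

Vtx : List ℕ → ℕ → Tableau → Set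
Vtx λ' n S = Σ Tableau (λ T → SSYT λ' n T × std T ≡ S)

Edge : ∀ {λ' n S} → ℕ → Vtx λ' n S → Vtx λ' n S → Set
Edge i u v = fTab i (proj₁ u) ≡ just (proj₁ v)

module Submission where

-- Let S be a standard tableau with m cells. A semistandard T with std T ≡ S is relabel a S, where a x is the
-- entry of T in the cell of S holding x, and the labellings a that occur are exactly the maps [1..m] → [1..n]
-- that weakly increase and strictly increase at the descents of S: standardization ranks cells by value and
-- then by column, and cells with equal values go weakly up and strictly right, so they are also read from
-- left to right in the reading word. Consequently, if a′ raises a single value i of a at cell j to i+1 and
-- both labellings are compatible, every i+1 of rw (relabel a S) is read after j and every other i before j,
-- so f_i acts at j; conversely f_i always raises a single letter i. Thus the vertices and edges of B(T_α)
-- are described by m and the descents of S alone, and these are determined by α.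

open import Defs
open import Axiom.UniquenessOfIdentityProofs.WithK using (uip)
open import Data.Bool using (Bool; true; false; if_then_else_; _∧_; _∨_; T)
open import Data.Bool.Properties using (T-≡; ∧-identityʳ; ∧-zeroʳ)
open import Data.List using (List; []; _∷_; [_]; _++_; length; map; concat; reverse; take; drop; filterᵇ; applyUpTo; upTo)
open import Data.List.Membership.Propositional using (_∈_; _∉_)
open import Data.List.Membership.Propositional.Properties
  using (∈-++⁺ˡ; ∈-++⁺ʳ; ∈-++⁻; ∈-map⁺; ∈-∃++; ∈-concat⁺′; ∈-applyUpTo⁺; ∈-applyUpTo⁻)
open import Data.List.Properties
  using (∷-injective; map-++; map-∘; map-id; map-cong-local; length-map; length-++; concat-map; take-map
        ; map-applyUpTo; reverse-map; reverse-involutive; unfold-reverse; concat-++; ++-identityʳ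
        ; length-drop; take++drop≡id; length-applyUpTo)
open import Data.List.Relation.Unary.All as All using (All; []; _∷_)
import Data.List.Relation.Unary.All.Properties as All
open import Data.List.Relation.Unary.AllPairs using ([]; _∷_)
open import Data.List.Relation.Unary.Any using (here; there)
open import Data.List.Relation.Unary.Linked as Linked using ([]; [-]; _∷_)
open import Data.List.Relation.Unary.Unique.Propositional using (Unique)
open import Data.List.Relation.Unary.Unique.Propositional.Properties as Unique using (Unique[x∷xs]⇒x∉xs)
open import Data.List.Relation.Binary.Permutation.Propositional using (_↭_; ↭-sym; ↭⇒↭ₛ)
open import Data.List.Relation.Binary.Permutation.Propositional.Properties
  using (∈-resp-↭; ↭-length; filter-↭; ++-comm; ++⁺ˡ; ↭-reverse)
import Data.List.Relation.Binary.Permutation.Setoid.Properties as Permutationₛ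
open import Data.Maybe using (just; nothing)
open import Data.Nat using (ℕ; zero; suc; _+_; _∸_; _≤_; _<_; _≡ᵇ_; _<ᵇ_; z≤n; s≤s)
open import Data.Nat.ListAction using (sum)
open import Data.Nat.ListAction.Properties using (sum-↭)
open import Data.Nat.Properties
open import Data.Product using (Σ; ∃; ∃₂; _×_; _,_; proj₁; proj₂)
open import Data.Sum using (_⊎_; inj₁; inj₂; map₂)
open import Data.Unit using (tt)
open import Function using (_∘_; id)
open import Function.Bundles using (_↔_; _⇔_; Inverse; Equivalence; mk↔ₛ′; mk⇔)
open import Relation.Binary.Definitions using (tri<; tri≈; tri>)
open import Relation.Binary.PropositionalEquality
  using (_≡_; _≢_; refl; sym; trans; cong; cong₂; subst; subst₂; setoid; module ≡-Reasoning)
open import Relation.Nullary using (contradiction)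
open import Relation.Nullary.Decidable using (T?)

true≢false : true ≢ false
true≢false ()

<ᵇ≡true⇒< : ∀ {m n} → (m <ᵇ n) ≡ true → m < n
<ᵇ≡true⇒< {m} {n} e = <ᵇ⇒< m n (subst T (sym e) tt)

<⇒<ᵇ≡true : ∀ {m n} → m < n → (m <ᵇ n) ≡ true
<⇒<ᵇ≡true m<n = Equivalence.to T-≡ (<⇒<ᵇ m<n)

<ᵇ≡false⇒≥ : ∀ {m n} → (m <ᵇ n) ≡ false → n ≤ m
<ᵇ≡false⇒≥ e = ≮⇒≥ λ m<n → true≢false (trans (sym (<⇒<ᵇ≡true m<n)) e)

≥⇒<ᵇ≡false : ∀ {m n} → n ≤ m → (m <ᵇ n) ≡ false
≥⇒<ᵇ≡false {m} {n} n≤m with m <ᵇ n in e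
... | true  = contradiction (<ᵇ≡true⇒< e) (≤⇒≯ n≤m)
... | false = refl

≡ᵇ≡true⇒≡ : ∀ {m n} → (m ≡ᵇ n) ≡ true → m ≡ n
≡ᵇ≡true⇒≡ {m} {n} e = ≡ᵇ⇒≡ m n (subst T (sym e) tt)

≡⇒≡ᵇ≡true : ∀ {m n} → m ≡ n → (m ≡ᵇ n) ≡ true
≡⇒≡ᵇ≡true {m} {n} m≡n = Equivalence.to T-≡ (≡⇒≡ᵇ m n m≡n)

≢⇒≡ᵇ≡false : ∀ {m n} → m ≢ n → (m ≡ᵇ n) ≡ false
≢⇒≡ᵇ≡false {m} {n} m≢n with m ≡ᵇ n in e
... | true  = contradiction (≡ᵇ≡true⇒≡ e) m≢n
... | false = refl

memᵇ≡true⇒∈ : ∀ {x} r → memᵇ x r ≡ true → x ∈ r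
memᵇ≡true⇒∈ {x} (y ∷ r) e with y ≡ᵇ x in e′
... | true  = here (sym (≡ᵇ≡true⇒≡ e′))
... | false = there (memᵇ≡true⇒∈ r e)

∈⇒memᵇ≡true : ∀ {x r} → x ∈ r → memᵇ x r ≡ true
∈⇒memᵇ≡true {x} {y ∷ r} (here refl) rewrite ≡⇒≡ᵇ≡true {y} refl = refl
∈⇒memᵇ≡true {x} {y ∷ r} (there x∈r) with y ≡ᵇ x
... | true  = refl
... | false = ∈⇒memᵇ≡true x∈r

∉⇒memᵇ≡false : ∀ {x} r → x ∉ r → memᵇ x r ≡ false
∉⇒memᵇ≡false {x} r x∉r with memᵇ x r in e
... | true  = contradiction (memᵇ≡true⇒∈ r e) x∉r
... | false = refl

countᵇ : (ℕ → Bool) → List ℕ → ℕ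
countᵇ p xs = length (filterᵇ p xs)

countᵇ-++ : ∀ p xs ys → countᵇ p (xs ++ ys) ≡ countᵇ p xs + countᵇ p ys
countᵇ-++ p []       ys = refl
countᵇ-++ p (x ∷ xs) ys with p x
... | true  = cong suc (countᵇ-++ p xs ys)
... | false = countᵇ-++ p xs ys

countᵇ-map : ∀ p f xs → countᵇ p (map f xs) ≡ countᵇ (p ∘ f) xs
countᵇ-map p f []       = refl
countᵇ-map p f (x ∷ xs) with p (f x)
... | true  = cong suc (countᵇ-map p f xs)
... | false = countᵇ-map p f xs

countᵇ-↭ : ∀ p {xs ys} → xs ↭ ys → countᵇ p xs ≡ countᵇ p ys
countᵇ-↭ p xs↭ys = ↭-length (filter-↭ (T? ∘ p) xs↭ys)

countᵇ-cong : ∀ p q xs → (∀ {x} → x ∈ xs → p x ≡ q x) → countᵇ p xs ≡ countᵇ q xs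
countᵇ-cong p q []       p≗q = refl
countᵇ-cong p q (x ∷ xs) p≗q with p x | q x | p≗q (here refl)
... | true  | .true  | refl = cong suc (countᵇ-cong p q xs (p≗q ∘ there))
... | false | .false | refl = countᵇ-cong p q xs (p≗q ∘ there)

countᵇ-∷-cong : ∀ p q {x y} {xs ys} → p x ≡ q y → countᵇ p xs ≡ countᵇ q ys → countᵇ p (x ∷ xs) ≡ countᵇ q (y ∷ ys)
countᵇ-∷-cong p q {x} {y} px≡qy eq with p x | q y | px≡qy
... | true  | .true  | refl = cong suc eq
... | false | .false | refl = eq

countᵇ-mono : ∀ p q xs → (∀ {x} → x ∈ xs → p x ≡ true → q x ≡ true) → countᵇ p xs ≤ countᵇ q xs
countᵇ-mono p q []       p⇒q = z≤n
countᵇ-mono p q (x ∷ xs) p⇒q with p x in px | q x in qx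
... | true  | true  = s≤s (countᵇ-mono p q xs (p⇒q ∘ there))
... | false | true  = m≤n⇒m≤1+n (countᵇ-mono p q xs (p⇒q ∘ there))
... | false | false = countᵇ-mono p q xs (p⇒q ∘ there)
... | true  | false with () ← trans (sym (p⇒q (here refl) px)) qx

countᵇ-mono-< : ∀ p q xs {y} → (∀ {x} → x ∈ xs → p x ≡ true → q x ≡ true) →
                y ∈ xs → p y ≡ false → q y ≡ true → countᵇ p xs < countᵇ q xs
countᵇ-mono-< p q (x ∷ xs) p⇒q (here refl) py qy rewrite py | qy = s≤s (countᵇ-mono p q xs (p⇒q ∘ there))
countᵇ-mono-< p q (x ∷ xs) p⇒q (there y∈xs) py qy with p x in px | q x in qx
... | true  | true  = s≤s (countᵇ-mono-< p q xs (p⇒q ∘ there) y∈xs py qy)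
... | false | true  = m<n⇒m<1+n (countᵇ-mono-< p q xs (p⇒q ∘ there) y∈xs py qy)
... | false | false = countᵇ-mono-< p q xs (p⇒q ∘ there) y∈xs py qy
... | true  | false with () ← trans (sym (p⇒q (here refl) px)) qx

countᵇ-∨ : ∀ p q xs → (∀ x → (p x ∧ q x) ≡ false) → countᵇ p xs + countᵇ q xs ≡ countᵇ (λ x → p x ∨ q x) xs
countᵇ-∨ p q []       disjoint = refl
countᵇ-∨ p q (x ∷ xs) disjoint with p x | q x | disjoint x
... | true  | false | _ = cong suc (countᵇ-∨ p q xs disjoint)
... | false | true  | _ = trans (+-suc (countᵇ p xs) (countᵇ q xs)) (cong suc (countᵇ-∨ p q xs disjoint))
... | false | false | _ = countᵇ-∨ p q xs disjoint

countᵇ-false : ∀ xs → countᵇ (λ _ → false) xs ≡ 0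
countᵇ-false []       = refl
countᵇ-false (_ ∷ xs) = countᵇ-false xs

countᵇ-<-upTo : ∀ {k} m → k ≤ m → countᵇ (_<ᵇ k) (upTo m) ≡ k
countᵇ-<-upTo {zero}  m       _         = countᵇ-false (upTo m)
countᵇ-<-upTo {suc k} (suc m) (s≤s k≤m) = cong suc (begin
  countᵇ (_<ᵇ suc k) (applyUpTo suc m)   ≡⟨ cong (countᵇ (_<ᵇ suc k)) (sym (map-applyUpTo id suc m)) ⟩
  countᵇ (_<ᵇ suc k) (map suc (upTo m))  ≡⟨ countᵇ-map (_<ᵇ suc k) suc (upTo m) ⟩
  countᵇ (_<ᵇ k) (upTo m)                ≡⟨ countᵇ-<-upTo m k≤m ⟩
  k                                      ∎)
  where open ≡-Reasoning

map≡map⇒≡ : ∀ {f g : ℕ → ℕ} {w x} → map f w ≡ map g w → x ∈ w → f x ≡ g x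
map≡map⇒≡ {w = y ∷ w} eq (here refl) = proj₁ (∷-injective eq)
map≡map⇒≡ {w = y ∷ w} eq (there x∈w) = map≡map⇒≡ (proj₂ (∷-injective eq)) x∈w

∈-filterᵇ⁺ : ∀ (f : ℕ → Bool) {xs x} → x ∈ xs → f x ≡ true → x ∈ filterᵇ f xs
∈-filterᵇ⁺ f {y ∷ xs} (here refl) fx rewrite fx = here refl
∈-filterᵇ⁺ f {y ∷ xs} (there x∈) fx with f y
... | true  = there (∈-filterᵇ⁺ f x∈ fx)
... | false = ∈-filterᵇ⁺ f x∈ fx

∈-filterᵇ⁻ : ∀ (f : ℕ → Bool) xs {x} → x ∈ filterᵇ f xs → f x ≡ true
∈-filterᵇ⁻ f (y ∷ xs) x∈ with f y in fy | x∈
... | true  | here refl = fy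
... | true  | there x∈′ = ∈-filterᵇ⁻ f xs x∈′
... | false | x∈′       = ∈-filterᵇ⁻ f xs x∈′

filterᵇ-≡⇒≡ : ∀ (f g : ℕ → Bool) {xs x} → filterᵇ f xs ≡ filterᵇ g xs → x ∈ xs → f x ≡ g x
filterᵇ-≡⇒≡ f g {xs} {x} eq x∈ with f x in fx | g x in gx
... | true  | true  = refl
... | false | false = refl
... | true  | false = contradiction (trans (sym (∈-filterᵇ⁻ g xs (subst (x ∈_) eq (∈-filterᵇ⁺ f x∈ fx)))) gx) true≢false
... | false | true  = contradiction (trans (sym (∈-filterᵇ⁻ f xs (subst (x ∈_) (sym eq) (∈-filterᵇ⁺ g x∈ gx)))) fx) true≢false

Unique-++⁻ˡ : ∀ (xs : List ℕ) {ys} → Unique (xs ++ ys) → Unique xs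
Unique-++⁻ˡ []       _          = []
Unique-++⁻ˡ (x ∷ xs) (x≢ ∷ xs!) = All.++⁻ˡ xs x≢ ∷ Unique-++⁻ˡ xs xs!

Unique-++⁻ʳ : ∀ (xs : List ℕ) {ys} → Unique (xs ++ ys) → Unique ys
Unique-++⁻ʳ []       ys!       = ys!
Unique-++⁻ʳ (x ∷ xs) (_ ∷ xs!) = Unique-++⁻ʳ xs xs!

Unique-++⇒∉ : ∀ (xs : List ℕ) {ys x} → Unique (xs ++ ys) → x ∈ xs → x ∉ ys
Unique-++⇒∉ (x ∷ xs) (x≢ ∷ _)   (here refl)  = All.All¬⇒¬Any (All.++⁻ʳ xs x≢)
Unique-++⇒∉ (_ ∷ xs) (_ ∷ xs!) (there x∈xs) = Unique-++⇒∉ xs xs! x∈xs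

Unique-resp-↭ : ∀ {xs ys : List ℕ} → xs ↭ ys → Unique xs → Unique ys
Unique-resp-↭ xs↭ys = Permutationₛ.Unique-resp-↭ (setoid ℕ) (↭⇒↭ₛ xs↭ys)

[1‥_] : ℕ → List ℕ
[1‥ m ] = applyUpTo suc m

Unique-[1‥] : ∀ m → Unique [1‥ m ]
Unique-[1‥] m = Unique.applyUpTo⁺₁ suc m (λ i<j _ → <⇒≢ (s≤s i<j))

∈-[1‥]⁻ : ∀ {x} m → x ∈ [1‥ m ] → 1 ≤ x × x ≤ m
∈-[1‥]⁻ m x∈ with i , i<m , refl ← ∈-applyUpTo⁻ suc x∈ = s≤s z≤n , i<m

∈-[1‥]⁺ : ∀ {x} m → 1 ≤ x → x ≤ m → x ∈ [1‥ m ]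
∈-[1‥]⁺ {suc k} m _ k<m = ∈-applyUpTo⁺ suc k<m

nth : List ℕ → ℕ → ℕ
nth []       _       = 0
nth (x ∷ xs) zero    = x
nth (x ∷ xs) (suc k) = nth xs k

rowAt : Tableau → ℕ → List ℕ
rowAt []       _       = []
rowAt (r ∷ rs) zero    = r
rowAt (r ∷ rs) (suc i) = rowAt rs i

entryAt : Tableau → ℕ → ℕ → ℕ
entryAt T i k = nth (rowAt T i) k

indexOf : ℕ → List ℕ → ℕ
indexOf x []       = 0
indexOf x (y ∷ ys) = if y ≡ᵇ x then 0 else suc (indexOf x ys)

colOf : Tableau → ℕ → ℕ
colOf []       x = 0
colOf (r ∷ rs) x = if memᵇ x r then indexOf x r else colOf rs x

nth-∈ : ∀ r {k} → k < length r → nth r k ∈ r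
nth-∈ (x ∷ r) {zero}  _         = here refl
nth-∈ (x ∷ r) {suc k} (s≤s k<) = there (nth-∈ r k<)

nth-indexOf : ∀ {x} r → x ∈ r → nth r (indexOf x r) ≡ x × indexOf x r < length r
nth-indexOf {x} (y ∷ r) x∈ with y ≡ᵇ x in e | x∈
... | true  | _           = ≡ᵇ≡true⇒≡ e , s≤s z≤n
... | false | here refl   = contradiction (trans (sym (≡⇒≡ᵇ≡true {y} refl)) e) true≢false
... | false | there x∈r with nth-indexOf r x∈r
...   | nth≡x , idx< = nth≡x , s≤s idx<

indexOf-nth : ∀ r {k} → Unique r → k < length r → indexOf (nth r k) r ≡ k
indexOf-nth (x ∷ r) {zero}  _          _        rewrite ≡⇒≡ᵇ≡true {x} refl = refl
indexOf-nth (x ∷ r) {suc k} (x≢ ∷ r!) (s≤s k<)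
  rewrite ≢⇒≡ᵇ≡false (All.lookup x≢ (nth-∈ r k<)) = cong suc (indexOf-nth r r! k<)

entryAt-∈ : ∀ S {i k} → i < length S → k < length (rowAt S i) → entryAt S i k ∈ concat S
entryAt-∈ (r ∷ S) {zero}  _        k< = ∈-++⁺ˡ (nth-∈ r k<)
entryAt-∈ (r ∷ S) {suc i} (s≤s i<) k< = ∈-++⁺ʳ r (entryAt-∈ S i< k<)

colOf-<-length : ∀ S {x} → x ∈ concat S → colOf S x < length (rowAt S (rowOf S x))
colOf-<-length (r ∷ S) {x} x∈ with memᵇ x r in e | ∈-++⁻ r x∈
... | true  | _          = proj₂ (nth-indexOf r (memᵇ≡true⇒∈ r e))
... | false | inj₁ x∈r   = contradiction (trans (sym (∈⇒memᵇ≡true x∈r)) e) true≢false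
... | false | inj₂ x∈S   = colOf-<-length S x∈S

entryAt-rowOf-colOf : ∀ S {x} → x ∈ concat S → entryAt S (rowOf S x) (colOf S x) ≡ x
entryAt-rowOf-colOf (r ∷ S) {x} x∈ with memᵇ x r in e | ∈-++⁻ r x∈
... | true  | _          = proj₁ (nth-indexOf r (memᵇ≡true⇒∈ r e))
... | false | inj₁ x∈r   = contradiction (trans (sym (∈⇒memᵇ≡true x∈r)) e) true≢false
... | false | inj₂ x∈S   = entryAt-rowOf-colOf S x∈S

rowOf-colOf-entryAt : ∀ S {i k} → Unique (concat S) → i < length S → k < length (rowAt S i) →
  rowOf S (entryAt S i k) ≡ i × colOf S (entryAt S i k) ≡ k
rowOf-colOf-entryAt (r ∷ S) {zero} {k} S! _ k<
  rewrite ∈⇒memᵇ≡true (nth-∈ r k<) = refl , indexOf-nth r (Unique-++⁻ˡ r S!) k<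
rowOf-colOf-entryAt (r ∷ S) {suc i} {k} S! (s≤s i<) k<
  rewrite ∉⇒memᵇ≡false r (λ x∈r → Unique-++⇒∉ r S! x∈r (entryAt-∈ S i< k<))
  = let row≡ , col≡ = rowOf-colOf-entryAt S (Unique-++⁻ʳ r S!) i< k< in cong suc row≡ , col≡

nth-mono : ∀ r {c₁ c₂} → RowWeak r → c₁ ≤ c₂ → c₂ < length r → nth r c₁ ≤ nth r c₂
nth-mono (x ∷ r)     {zero}   {zero}   _           _         _        = ≤-refl
nth-mono (x ∷ y ∷ r) {zero}   {suc c₂} (x≤y ∷ r↑)  _         (s≤s c₂<) = ≤-trans x≤y (nth-mono (y ∷ r) r↑ z≤n c₂<)
nth-mono (x ∷ y ∷ r) {suc c₁} {suc c₂} (_ ∷ r↑)    (s≤s c≤c) (s≤s c₂<) = nth-mono (y ∷ r) r↑ c≤c c₂<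
nth-mono (x ∷ [])    {_}      {suc c₂} _           _         (s≤s ())

ColStrict⇒nth-< : ∀ r r′ {c} → ColStrict r r′ → c < length r′ → nth r c < nth r′ c
ColStrict⇒nth-< (a ∷ r) (b ∷ r′) {zero}  (a<b , _) _        = a<b
ColStrict⇒nth-< (a ∷ r) (b ∷ r′) {suc c} (_ , rr′) (s≤s c<) = ColStrict⇒nth-< r r′ rr′ c<

ColStrict⇒length-≥ : ∀ r r′ → ColStrict r r′ → length r′ ≤ length r
ColStrict⇒length-≥ r       []       _         = z≤n
ColStrict⇒length-≥ (a ∷ r) (b ∷ r′) (_ , rr′) = s≤s (ColStrict⇒length-≥ r r′ rr′)

ColsStrict⇒ColStrict-rowAt : ∀ T i → ColsStrict T → ColStrict (rowAt T i) (rowAt T (suc i))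
ColsStrict⇒ColStrict-rowAt []           i       _         = tt
ColsStrict⇒ColStrict-rowAt (r ∷ [])     zero    _         = tt
ColsStrict⇒ColStrict-rowAt (r ∷ [])     (suc i) _         = tt
ColsStrict⇒ColStrict-rowAt (r ∷ r′ ∷ T) zero    (rr′ , _) = rr′
ColsStrict⇒ColStrict-rowAt (r ∷ r′ ∷ T) (suc i) (_ , T↓)  = ColsStrict⇒ColStrict-rowAt (r′ ∷ T) i T↓

length-rowAt-antitone : ∀ T {i j} → ColsStrict T → i ≤ j → length (rowAt T j) ≤ length (rowAt T i)
length-rowAt-antitone T {j = zero}  T↓ z≤n = ≤-refl
length-rowAt-antitone T {i} {suc j} T↓ i≤1+j with m≤n⇒m<n∨m≡n i≤1+j
... | inj₂ refl      = ≤-refl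
... | inj₁ (s≤s i≤j) = ≤-trans (ColStrict⇒length-≥ _ _ (ColsStrict⇒ColStrict-rowAt T j T↓))
                                (length-rowAt-antitone T T↓ i≤j)

rowAt-nonempty⇒< : ∀ T j → 0 < length (rowAt T j) → j < length T
rowAt-nonempty⇒< (r ∷ T) zero    _  = s≤s z≤n
rowAt-nonempty⇒< (r ∷ T) (suc j) 0< = s≤s (rowAt-nonempty⇒< T j 0<)

RowWeak-rowAt : ∀ T i → All RowWeak T → RowWeak (rowAt T i)
RowWeak-rowAt []      i       _          = []
RowWeak-rowAt (r ∷ T) zero    (r→ ∷ _)  = r→
RowWeak-rowAt (r ∷ T) (suc i) (_ ∷ T→)  = RowWeak-rowAt T i T→

entryAt-<-below : ∀ T {i j c} → ColsStrict T → i < j → c < length (rowAt T j) → entryAt T i c < entryAt T j c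
entryAt-<-below T {i} {suc j} {c} T↓ (s≤s i≤j) c< with m≤n⇒m<n∨m≡n i≤j
... | inj₂ refl = ColStrict⇒nth-< _ _ (ColsStrict⇒ColStrict-rowAt T i T↓) c<
... | inj₁ i<j  = <-trans (entryAt-<-below T T↓ i<j (≤-trans c< (ColStrict⇒length-≥ _ _ (ColsStrict⇒ColStrict-rowAt T j T↓))))
                          (ColStrict⇒nth-< _ _ (ColsStrict⇒ColStrict-rowAt T j T↓) c<)

entryAt-<-southeast : ∀ T {i j c d} → All RowWeak T → ColsStrict T → i < j → c ≤ d → d < length (rowAt T j) →
                      entryAt T i c < entryAt T j d
entryAt-<-southeast T {i} {j} T→ T↓ i<j c≤d d< =
  ≤-<-trans (nth-mono (rowAt T i) (RowWeak-rowAt T i T→) c≤d (≤-trans d< (length-rowAt-antitone T T↓ (<⇒≤ i<j))))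
            (entryAt-<-below T T↓ i<j d<)

rw-∷ : ∀ r rs → rw (r ∷ rs) ≡ rw rs ++ r
rw-∷ r rs = trans (cong concat (unfold-reverse r rs))
                  (trans (sym (concat-++ (reverse rs) [ r ])) (cong (rw rs ++_) (++-identityʳ r)))

rw-↭ : ∀ S → rw S ↭ concat S
rw-↭ []       = _↭_.refl
rw-↭ (r ∷ rs) rewrite rw-∷ r rs = _↭_.trans (++-comm (rw rs) r) (++⁺ˡ r (rw-↭ rs))

indexOf-++ˡ : ∀ {x} A B → x ∈ A → indexOf x (A ++ B) ≡ indexOf x A
indexOf-++ˡ {x} (y ∷ A) B x∈ with y ≡ᵇ x in e | x∈
... | true  | _          = refl
... | false | here refl  = contradiction (trans (sym (≡⇒≡ᵇ≡true {y} refl)) e) true≢false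
... | false | there x∈A = cong suc (indexOf-++ˡ A B x∈A)

indexOf-++ʳ : ∀ {x} A B → x ∉ A → indexOf x (A ++ B) ≡ length A + indexOf x B
indexOf-++ʳ     []      B _   = refl
indexOf-++ʳ {x} (y ∷ A) B x∉ rewrite ≢⇒≡ᵇ≡false {y} {x} (λ y≡x → x∉ (here (sym y≡x)))
  = cong suc (indexOf-++ʳ A B (x∉ ∘ there))

indexOf-middle : ∀ W₁ {j} W₂ → j ∉ W₁ → indexOf j (W₁ ++ j ∷ W₂) ≡ length W₁
indexOf-middle W₁ {j} W₂ j∉ rewrite indexOf-++ʳ W₁ (j ∷ W₂) j∉ | ≡⇒≡ᵇ≡true {j} refl = +-identityʳ (length W₁)

indexOf-prefix : ∀ W₁ {x} W → x ∈ W₁ → indexOf x (W₁ ++ W) < length W₁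
indexOf-prefix W₁ W x∈ rewrite indexOf-++ˡ W₁ W x∈ = proj₂ (nth-indexOf W₁ x∈)

indexOf-suffix : ∀ W₁ {j x} W₂ → x ∉ W₁ → x ≢ j → length W₁ < indexOf x (W₁ ++ j ∷ W₂)
indexOf-suffix W₁ {j} {x} W₂ x∉ x≢j rewrite indexOf-++ʳ W₁ (j ∷ W₂) x∉ | ≢⇒≡ᵇ≡false (x≢j ∘ sym) =
  m<m+n (length W₁) (s≤s z≤n)

cellsBelow : Tableau → ℕ → ℕ
cellsBelow S i = length (concat (drop (suc i) S))

indexOf-rw : ∀ S {x} → Unique (concat S) → x ∈ concat S → indexOf x (rw S) ≡ cellsBelow S (rowOf S x) + colOf S x
indexOf-rw (r ∷ S) {x} S! x∈ rewrite rw-∷ r S with memᵇ x r in e | ∈-++⁻ r x∈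
... | true | _ = trans (indexOf-++ʳ (rw S) r (λ x∈S → Unique-++⇒∉ r S! (memᵇ≡true⇒∈ r e) (∈-resp-↭ (rw-↭ S) x∈S)))
                       (cong (_+ indexOf x r) (↭-length (rw-↭ S)))
... | false | inj₁ x∈r = contradiction (trans (sym (∈⇒memᵇ≡true x∈r)) e) true≢false
... | false | inj₂ x∈S = trans (indexOf-++ˡ (rw S) r (∈-resp-↭ (↭-sym (rw-↭ S)) x∈S))
                               (indexOf-rw S (Unique-++⁻ʳ r S!) x∈S)

length-concat-drop : ∀ S j → length (concat (drop j S)) ≡ length (rowAt S j) + length (concat (drop (suc j) S))
length-concat-drop []      zero    = refl
length-concat-drop []      (suc j) = refl
length-concat-drop (r ∷ S) zero    = length-++ r
length-concat-drop (r ∷ S) (suc j) = length-concat-drop S j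

length-concat-drop-antitone : ∀ S {i j} → i ≤ j → length (concat (drop j S)) ≤ length (concat (drop i S))
length-concat-drop-antitone S {j = zero}  z≤n = ≤-refl
length-concat-drop-antitone S {i} {suc j} i≤1+j with m≤n⇒m<n∨m≡n i≤1+j
... | inj₂ refl      = ≤-refl
... | inj₁ (s≤s i≤j) = ≤-trans (≤-trans (m≤n+m _ (length (rowAt S j))) (≤-reflexive (sym (length-concat-drop S j))))
                               (length-concat-drop-antitone S i≤j)

rw-precedes-higher-row : ∀ S {x y} → Unique (concat S) → x ∈ concat S → y ∈ concat S →
                         rowOf S y < rowOf S x → indexOf x (rw S) < indexOf y (rw S)
rw-precedes-higher-row S {x} {y} S! x∈ y∈ row< rewrite indexOf-rw S S! x∈ | indexOf-rw S S! y∈ = begin-strict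
  cellsBelow S (rowOf S x) + colOf S x
    <⟨ +-monoʳ-< (cellsBelow S (rowOf S x)) (colOf-<-length S x∈) ⟩
  cellsBelow S (rowOf S x) + length (rowAt S (rowOf S x))
    ≡⟨ trans (+-comm (cellsBelow S (rowOf S x)) _) (sym (length-concat-drop S (rowOf S x))) ⟩
  length (concat (drop (rowOf S x) S))
    ≤⟨ length-concat-drop-antitone S row< ⟩
  cellsBelow S (rowOf S y)
    ≤⟨ m≤m+n _ _ ⟩
  cellsBelow S (rowOf S y) + colOf S y ∎
  where open ≤-Reasoning

rw-precedes-same-row : ∀ S {x y} → Unique (concat S) → x ∈ concat S → y ∈ concat S →
                       rowOf S y ≡ rowOf S x → colOf S x < colOf S y → indexOf x (rw S) < indexOf y (rw S)
rw-precedes-same-row S {x} {y} S! x∈ y∈ row≡ col<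
  rewrite indexOf-rw S S! x∈ | indexOf-rw S S! y∈ | row≡ = +-monoʳ-< _ col<

length-concat : ∀ (R : Tableau) → length (concat R) ≡ sum (map length R)
length-concat []      = refl
length-concat (r ∷ R) = trans (length-++ r) (cong (length r +_) (length-concat R))

length-rw : ∀ T → length (rw T) ≡ sum (shape T)
length-rw T = trans (↭-length (rw-↭ T)) (length-concat T)

cut-concat : ∀ R → cut (map length R) (concat R) ≡ R
cut-concat []      = refl
cut-concat (r ∷ R) = cong₂ _∷_ (take-++ r) (trans (cong (cut (map length R)) (drop-++ r)) (cut-concat R))
  where
  take-++ : ∀ r {X} → take (length r) (r ++ X) ≡ r
  take-++ []      = refl
  take-++ (x ∷ r) = cong (x ∷_) (take-++ r)
  drop-++ : ∀ r {X} → drop (length r) (r ++ X) ≡ X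
  drop-++ []      = refl
  drop-++ (x ∷ r) = drop-++ r

concat-cut : ∀ ks u → length u ≡ sum ks → concat (cut ks u) ≡ u
concat-cut []       []  _ = refl
concat-cut (k ∷ ks) u len≡ = trans (cong (take k u ++_) (concat-cut ks (drop k u) len-drop≡)) (take++drop≡id k u)
  where len-drop≡ = trans (length-drop k u) (trans (cong (_∸ k) len≡) (m+n∸m≡n k (sum ks)))

fromRw-rw : ∀ T → fromRw (shape T) (rw T) ≡ T
fromRw-rw T = begin
  reverse (cut (reverse (map length T)) (rw T))   ≡⟨ cong (λ ks → reverse (cut ks (rw T))) (reverse-map length T) ⟨
  reverse (cut (map length (reverse T)) (rw T))   ≡⟨ cong reverse (cut-concat (reverse T)) ⟩
  reverse (reverse T)                             ≡⟨ reverse-involutive T ⟩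
  T ∎
  where open ≡-Reasoning

rw-fromRw : ∀ λ′ u → length u ≡ sum λ′ → rw (fromRw λ′ u) ≡ u
rw-fromRw λ′ u len≡ = trans (cong concat (reverse-involutive (cut (reverse λ′) u)))
                            (concat-cut (reverse λ′) u (trans len≡ (sym (sum-↭ (↭-reverse λ′)))))

relabel : (ℕ → ℕ) → Tableau → Tableau
relabel a = map (map a)

relabel-cong : ∀ S {a b} → (∀ {x} → x ∈ concat S → a x ≡ b x) → relabel a S ≡ relabel b S
relabel-cong S a≗b = map-cong-local (All.tabulate λ r∈S → map-cong-local (All.tabulate λ x∈r → a≗b (∈-concat⁺′ x∈r r∈S)))

relabel-id : ∀ S → relabel id S ≡ S
relabel-id S = trans (map-cong-local (All.tabulate λ _ → map-id _)) (map-id S)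

relabel≡⇒fixed : ∀ S {a} → relabel a S ≡ S → ∀ {x} → x ∈ concat S → a x ≡ x
relabel≡⇒fixed S {a} eq = map≡map⇒≡ (begin
  map a (concat S)        ≡⟨ concat-map S ⟨
  concat (relabel a S)    ≡⟨ cong concat eq ⟩
  concat S                ≡⟨ map-id (concat S) ⟨
  map id (concat S)       ∎)
  where open ≡-Reasoning

shape-relabel : ∀ a S → shape (relabel a S) ≡ shape S
shape-relabel a S = trans (sym (map-∘ S)) (map-cong-local (All.tabulate λ {r} _ → length-map a r))

rowAt-relabel : ∀ a S i → rowAt (relabel a S) i ≡ map a (rowAt S i)
rowAt-relabel a []      i       = refl
rowAt-relabel a (r ∷ S) zero    = refl
rowAt-relabel a (r ∷ S) (suc i) = rowAt-relabel a S i

nth-map : ∀ a r {k} → k < length r → nth (map a r) k ≡ a (nth r k)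
nth-map a (x ∷ r) {zero}  _        = refl
nth-map a (x ∷ r) {suc k} (s≤s k<) = nth-map a r k<

entryAt-relabel : ∀ a S {i k} → k < length (rowAt S i) → entryAt (relabel a S) i k ≡ a (entryAt S i k)
entryAt-relabel a S {i} k< rewrite rowAt-relabel a S i = nth-map a (rowAt S i) k<

length-rowAt-relabel : ∀ a S i → length (rowAt (relabel a S) i) ≡ length (rowAt S i)
length-rowAt-relabel a S i = trans (cong length (rowAt-relabel a S i)) (length-map a (rowAt S i))

rw-relabel : ∀ a S → rw (relabel a S) ≡ map a (rw S)
rw-relabel a S = trans (cong concat (sym (reverse-map (map a) S))) (concat-map (reverse S))

fromRw-relabel : ∀ a a′ S → fromRw (shape (relabel a S)) (rw (relabel a′ S)) ≡ relabel a′ S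
fromRw-relabel a a′ S = trans (cong (λ sh → fromRw sh (rw (relabel a′ S))) (trans (shape-relabel a S) (sym (shape-relabel a′ S))))
                              (fromRw-rw (relabel a′ S))

RowWeak-map : ∀ a r → RowWeak r → (∀ {x y} → x ∈ r → y ∈ r → x ≤ y → a x ≤ a y) → RowWeak (map a r)
RowWeak-map a []          _          _    = []
RowWeak-map a (x ∷ [])    _          _    = [-]
RowWeak-map a (x ∷ y ∷ r) (x≤y ∷ r→) mono =
  mono (here refl) (there (here refl)) x≤y ∷ RowWeak-map a (y ∷ r) r→ (λ x∈ y∈ → mono (there x∈) (there y∈))

ColStrict-map : ∀ a r r′ → ColStrict r r′ → (∀ {k} → k < length r′ → a (nth r k) < a (nth r′ k)) →
                ColStrict (map a r) (map a r′)
ColStrict-map a r       []       _         _   = tt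
ColStrict-map a (x ∷ r) (y ∷ r′) (_ , rr′) a< = a< (s≤s z≤n) , ColStrict-map a r r′ rr′ (a< ∘ s≤s)

ColsStrict-relabel : ∀ a S → ColsStrict S →
                     (∀ i {k} → k < length (rowAt S (suc i)) → a (entryAt S i k) < a (entryAt S (suc i) k)) →
                     ColsStrict (relabel a S)
ColsStrict-relabel a []           _          _  = tt
ColsStrict-relabel a (r ∷ [])     _          _  = tt
ColsStrict-relabel a (r ∷ r′ ∷ S) (rr′ , S↓) a< =
  ColStrict-map a r r′ rr′ (a< 0) , ColsStrict-relabel a (r′ ∷ S) S↓ (a< ∘ suc)

labelling : Tableau → Tableau → ℕ → ℕ
labelling S T x = entryAt T (rowOf S x) (colOf S x)

labelling-relabel : ∀ a S {x} → x ∈ concat S → labelling S (relabel a S) x ≡ a x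
labelling-relabel a S x∈ = trans (entryAt-relabel a S (colOf-<-length S x∈)) (cong a (entryAt-rowOf-colOf S x∈))

map-nth : ∀ f r t → length r ≡ length t → (∀ {k} → k < length r → f (nth r k) ≡ nth t k) → map f r ≡ t
map-nth f []      []      _    _   = refl
map-nth f (x ∷ r) (y ∷ t) len≡ f≡ = cong₂ _∷_ (f≡ (s≤s z≤n)) (map-nth f r t (suc-injective len≡) (f≡ ∘ s≤s))

relabel-entryAt : ∀ f S T → shape S ≡ shape T →
                  (∀ i {k} → k < length (rowAt S i) → f (entryAt S i k) ≡ entryAt T i k) → relabel f S ≡ T
relabel-entryAt f []      []      _      _  = refl
relabel-entryAt f (r ∷ S) (t ∷ T) shape≡ f≡ with ∷-injective shape≡
... | len≡ , shape≡′ = cong₂ _∷_ (map-nth f r t len≡ (f≡ 0)) (relabel-entryAt f S T shape≡′ (f≡ ∘ suc))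

relabel-labelling : ∀ S T → Unique (concat S) → shape S ≡ shape T → relabel (labelling S T) S ≡ T
relabel-labelling S T S! shape≡ = relabel-entryAt (labelling S T) S T shape≡ λ i k< →
  let row≡ , col≡ = rowOf-colOf-entryAt S S! (rowAt-nonempty⇒< S i (≤-trans (s≤s z≤n) k<)) k<
  in cong₂ (entryAt T) row≡ col≡

-- Standardization of a relabelled standard tableau

precedesᵇ : (ℕ → ℕ) → (ℕ → ℕ) → ℕ → ℕ → Bool
precedesᵇ a col y x = (a y <ᵇ a x) ∨ ((a y ≡ᵇ a x) ∧ (col y <ᵇ col x))

rank : (ℕ → ℕ) → Tableau → ℕ → ℕ
rank a S x = countᵇ (λ y → precedesᵇ a (colOf S) y x) (concat S)

precedesᵇ≡true⇒ : ∀ a c {y x} → precedesᵇ a c y x ≡ true → a y < a x ⊎ (a y ≡ a x × c y < c x)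
precedesᵇ≡true⇒ a c {y} {x} e with a y <ᵇ a x in lt | a y ≡ᵇ a x in eq | c y <ᵇ c x in clt | e
... | true  | _    | _    | _ = inj₁ (<ᵇ≡true⇒< lt)
... | false | true | true | _ = inj₂ (≡ᵇ≡true⇒≡ eq , <ᵇ≡true⇒< clt)

<⇒precedesᵇ : ∀ a c {y x} → a y < a x → precedesᵇ a c y x ≡ true
<⇒precedesᵇ a c ay<ax rewrite <⇒<ᵇ≡true ay<ax = refl

≡∧<⇒precedesᵇ : ∀ a c {y x} → a y ≡ a x → c y < c x → precedesᵇ a c y x ≡ true
≡∧<⇒precedesᵇ a c {y} {x} ay≡ax cy<cx
  rewrite ≥⇒<ᵇ≡false {a y} {a x} (≤-reflexive (sym ay≡ax)) | ≡⇒≡ᵇ≡true ay≡ax | <⇒<ᵇ≡true cy<cx = refl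

precedesᵇ-irrefl : ∀ a c x → precedesᵇ a c x x ≡ false
precedesᵇ-irrefl a c x rewrite ≥⇒<ᵇ≡false {a x} ≤-refl | ≥⇒<ᵇ≡false {c x} ≤-refl with a x ≡ᵇ a x
... | true  = refl
... | false = refl

precedesᵇ-trans : ∀ a c {z y x} → precedesᵇ a c z y ≡ true → precedesᵇ a c y x ≡ true → precedesᵇ a c z x ≡ true
precedesᵇ-trans a c zy yx with precedesᵇ≡true⇒ a c zy | precedesᵇ≡true⇒ a c yx
... | inj₁ az<ay        | inj₁ ay<ax        = <⇒precedesᵇ a c (<-trans az<ay ay<ax)
... | inj₁ az<ay        | inj₂ (ay≡ax , _)  = <⇒precedesᵇ a c (<-≤-trans az<ay (≤-reflexive ay≡ax))
... | inj₂ (az≡ay , _)  | inj₁ ay<ax        = <⇒precedesᵇ a c (≤-<-trans (≤-reflexive az≡ay) ay<ax)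
... | inj₂ (az≡ay , cz<cy) | inj₂ (ay≡ax , cy<cx) = ≡∧<⇒precedesᵇ a c (trans az≡ay ay≡ax) (<-trans cz<cy cy<cx)

countᵇ-take : ∀ p r c → Unique r → countᵇ p (take c r) ≡ countᵇ (λ y → p y ∧ (indexOf y r <ᵇ c)) r
countᵇ-take p []      zero    _ = refl
countᵇ-take p []      (suc c) _ = refl
countᵇ-take p (y ∷ r) zero    _ = sym (trans (countᵇ-cong _ (λ _ → false) (y ∷ r) (λ {z} _ → ∧-zeroʳ (p z))) (countᵇ-false r))
countᵇ-take p (y ∷ r) (suc c) (y≢ ∷ r!) =
  countᵇ-∷-cong p (λ z → p z ∧ (indexOf z (y ∷ r) <ᵇ suc c)) head (trans (countᵇ-take p r c r!) (countᵇ-cong _ _ r shift))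
  where
  head : p y ≡ (p y ∧ (indexOf y (y ∷ r) <ᵇ suc c))
  head rewrite ≡⇒≡ᵇ≡true {y} refl = sym (∧-identityʳ (p y))
  shift : ∀ {z} → z ∈ r → (p z ∧ (indexOf z r <ᵇ c)) ≡ (p z ∧ (indexOf z (y ∷ r) <ᵇ suc c))
  shift z∈r rewrite ≢⇒≡ᵇ≡false (All.lookup y≢ z∈r) = refl

countᵇ-concat-relabel : ∀ p a S → countᵇ p (concat (relabel a S)) ≡ countᵇ (p ∘ a) (concat S)
countᵇ-concat-relabel p a S = trans (cong (countᵇ p) (concat-map S)) (countᵇ-map p a (concat S))

Unique-∈-row : ∀ S {r} → Unique (concat S) → r ∈ S → Unique r
Unique-∈-row (r ∷ S) S! (here refl) = Unique-++⁻ˡ r S!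
Unique-∈-row (r ∷ S) S! (there r∈S) = Unique-∈-row S (Unique-++⁻ʳ r S!) r∈S

colOf-∈-row : ∀ S {r y} → Unique (concat S) → r ∈ S → y ∈ r → colOf S y ≡ indexOf y r
colOf-∈-row (r ∷ S)  S! (here refl) y∈r rewrite ∈⇒memᵇ≡true y∈r = refl
colOf-∈-row (r₀ ∷ S) S! (there r∈S) y∈r
  rewrite ∉⇒memᵇ≡false r₀ (λ y∈r₀ → Unique-++⇒∉ r₀ S! y∈r₀ (∈-concat⁺′ y∈r r∈S))
  = colOf-∈-row S (Unique-++⁻ʳ r₀ S!) r∈S y∈r

sum-count-take-relabel : ∀ a S v c → Unique (concat S) →
  sum (map (λ row → count v (take c row)) (relabel a S)) ≡ countᵇ (λ y → (a y ≡ᵇ v) ∧ (colOf S y <ᵇ c)) (concat S)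
sum-count-take-relabel a []      v c _  = refl
sum-count-take-relabel a (r ∷ S) v c S! = begin
  count v (take c (map a r)) + sum (map (λ row → count v (take c row)) (relabel a S))
    ≡⟨ cong₂ _+_ row (sum-count-take-relabel a S v c (Unique-++⁻ʳ r S!)) ⟩
  countᵇ (λ y → (a y ≡ᵇ v) ∧ (indexOf y r <ᵇ c)) r + countᵇ (λ y → (a y ≡ᵇ v) ∧ (colOf S y <ᵇ c)) (concat S)
    ≡⟨ cong₂ _+_ (countᵇ-cong _ _ r colOf-here) (countᵇ-cong _ _ (concat S) colOf-there) ⟩
  countᵇ (λ y → (a y ≡ᵇ v) ∧ (colOf (r ∷ S) y <ᵇ c)) r + countᵇ (λ y → (a y ≡ᵇ v) ∧ (colOf (r ∷ S) y <ᵇ c)) (concat S)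
    ≡⟨ countᵇ-++ _ r (concat S) ⟨
  countᵇ (λ y → (a y ≡ᵇ v) ∧ (colOf (r ∷ S) y <ᵇ c)) (concat (r ∷ S)) ∎
  where
  open ≡-Reasoning
  row : count v (take c (map a r)) ≡ countᵇ (λ y → (a y ≡ᵇ v) ∧ (indexOf y r <ᵇ c)) r
  row = begin
    countᵇ (_≡ᵇ v) (take c (map a r))   ≡⟨ cong (countᵇ (_≡ᵇ v)) (take-map c r) ⟩
    countᵇ (_≡ᵇ v) (map a (take c r))   ≡⟨ countᵇ-map (_≡ᵇ v) a (take c r) ⟩
    countᵇ (λ y → a y ≡ᵇ v) (take c r)  ≡⟨ countᵇ-take (λ y → a y ≡ᵇ v) r c (Unique-++⁻ˡ r S!) ⟩
    countᵇ (λ y → (a y ≡ᵇ v) ∧ (indexOf y r <ᵇ c)) r ∎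
  colOf-here : ∀ {y} → y ∈ r → ((a y ≡ᵇ v) ∧ (indexOf y r <ᵇ c)) ≡ ((a y ≡ᵇ v) ∧ (colOf (r ∷ S) y <ᵇ c))
  colOf-here y∈r rewrite ∈⇒memᵇ≡true y∈r = refl
  colOf-there : ∀ {y} → y ∈ concat S → ((a y ≡ᵇ v) ∧ (colOf S y <ᵇ c)) ≡ ((a y ≡ᵇ v) ∧ (colOf (r ∷ S) y <ᵇ c))
  colOf-there y∈S rewrite ∉⇒memᵇ≡false r (λ y∈r → Unique-++⇒∉ r S! y∈r y∈S) = refl

stdRow-relabel : ∀ a S c suf → Unique (concat S) → Unique suf → (∀ {y} → y ∈ suf → colOf S y ≡ c + indexOf y suf) →
                 stdRow (relabel a S) c (map a suf) ≡ map (suc ∘ rank a S) suf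
stdRow-relabel a S c []         _  _          _     = refl
stdRow-relabel a S c (y ∷ suf) S! (y≢ ∷ suf!) col≡ = cong₂ _∷_ (cong suc head) (stdRow-relabel a S (suc c) suf S! suf! col≡′)
  where
  open ≡-Reasoning
  colOf-y : colOf S y ≡ c
  colOf-y = trans (col≡ (here refl)) (trans (cong (c +_) (cong (if_then 0 else suc (indexOf y suf)) (≡⇒≡ᵇ≡true {y} refl))) (+-identityʳ c))
  col≡′ : ∀ {z} → z ∈ suf → colOf S z ≡ suc c + indexOf z suf
  col≡′ {z} z∈ = trans (col≡ (there z∈)) (trans (cong (λ b → c + (if b then 0 else suc (indexOf z suf)))
                         (≢⇒≡ᵇ≡false (All.lookup y≢ z∈))) (+-suc c (indexOf z suf)))
  disjoint : ∀ z → ((a z <ᵇ a y) ∧ ((a z ≡ᵇ a y) ∧ (colOf S z <ᵇ colOf S y))) ≡ false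
  disjoint z with a z <ᵇ a y in lt | a z ≡ᵇ a y in eq
  ... | true  | true  = contradiction (≡ᵇ≡true⇒≡ {a z} eq) (<⇒≢ (<ᵇ≡true⇒< {a z} lt))
  ... | true  | false = refl
  ... | false | _     = refl
  head : countᵇ (_<ᵇ a y) (concat (relabel a S)) + sum (map (λ row → count (a y) (take c row)) (relabel a S))
         ≡ rank a S y
  head = begin
    countᵇ (_<ᵇ a y) (concat (relabel a S)) + sum (map (λ row → count (a y) (take c row)) (relabel a S))
      ≡⟨ cong₂ _+_ (countᵇ-concat-relabel (_<ᵇ a y) a S) (sum-count-take-relabel a S (a y) c S!) ⟩
    countᵇ (λ z → a z <ᵇ a y) (concat S) + countᵇ (λ z → (a z ≡ᵇ a y) ∧ (colOf S z <ᵇ c)) (concat S)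
      ≡⟨ cong (λ d → countᵇ (λ z → a z <ᵇ a y) (concat S) + countᵇ (λ z → (a z ≡ᵇ a y) ∧ (colOf S z <ᵇ d)) (concat S))
              (sym colOf-y) ⟩
    countᵇ (λ z → a z <ᵇ a y) (concat S) + countᵇ (λ z → (a z ≡ᵇ a y) ∧ (colOf S z <ᵇ colOf S y)) (concat S)
      ≡⟨ countᵇ-∨ _ _ (concat S) disjoint ⟩
    rank a S y ∎

std-relabel : ∀ a S → Unique (concat S) → std (relabel a S) ≡ relabel (suc ∘ rank a S) S
std-relabel a S S! = trans (sym (map-∘ S)) (map-cong-local (All.tabulate row))
  where
  row : ∀ {r} → r ∈ S → stdRow (relabel a S) 0 (map a r) ≡ map (suc ∘ rank a S) r
  row r∈S = stdRow-relabel a S 0 _ S! (Unique-∈-row S S! r∈S) (colOf-∈-row S S! r∈S)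

-- Crystal operators

SplitAt : ℕ → List ℕ → ℕ → ℕ → Set
SplitAt i u pos p = ∃₂ λ A B → u ≡ A ++ i ∷ B × p ≡ pos + length A

SplitAt-∷ : ∀ {i x u pos p} → SplitAt i u (suc pos) p → SplitAt i (x ∷ u) pos p
SplitAt-∷ {x = x} {pos = pos} (A , B , u≡ , p≡) = x ∷ A , B , cong (x ∷_) u≡ , trans p≡ (sym (+-suc pos (length A)))

lastUnmatched-just : ∀ i k u pos acc {p} → lastUnmatched i k u pos acc ≡ just p → acc ≡ just p ⊎ SplitAt i u pos p
lastUnmatched-just i k       []      pos acc e = inj₁ e
lastUnmatched-just i k       (x ∷ u) pos acc e with x ≡ᵇ suc i
... | true = map₂ SplitAt-∷ (lastUnmatched-just i (suc k) u (suc pos) acc e)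
... | false with x ≡ᵇ i in x≡i
lastUnmatched-just i zero    (x ∷ u) pos acc e | false | true with lastUnmatched-just i zero u (suc pos) (just pos) e
... | inj₁ refl  = inj₂ ([] , u , cong (_∷ u) (≡ᵇ≡true⇒≡ x≡i) , sym (+-identityʳ pos))
... | inj₂ split = inj₂ (SplitAt-∷ split)
lastUnmatched-just i (suc k) (x ∷ u) pos acc e | false | true =
  map₂ SplitAt-∷ (lastUnmatched-just i k u (suc pos) acc e)
lastUnmatched-just i k       (x ∷ u) pos acc e | false | false =
  map₂ SplitAt-∷ (lastUnmatched-just i k u (suc pos) acc e)

lastUnmatched-no-i : ∀ i k u pos acc → All (_≢ i) u → lastUnmatched i k u pos acc ≡ acc
lastUnmatched-no-i i k []      pos acc []          = refl
lastUnmatched-no-i i k (x ∷ u) pos acc (x≢i ∷ u≢i) with x ≡ᵇ suc i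
... | true  = lastUnmatched-no-i i (suc k) u (suc pos) acc u≢i
... | false rewrite ≢⇒≡ᵇ≡false x≢i = lastUnmatched-no-i i k u (suc pos) acc u≢i

lastUnmatched-no-i+1 : ∀ i A u pos acc → All (_≢ suc i) A →
                       ∃ λ acc′ → lastUnmatched i 0 (A ++ u) pos acc ≡ lastUnmatched i 0 u (pos + length A) acc′
lastUnmatched-no-i+1 i []      u pos acc []        = acc , cong (λ q → lastUnmatched i 0 u q acc) (sym (+-identityʳ pos))
lastUnmatched-no-i+1 i (x ∷ A) u pos acc (x≢ ∷ A≢) rewrite ≢⇒≡ᵇ≡false x≢ with x ≡ᵇ i
... | true  = let acc′ , e = lastUnmatched-no-i+1 i A u (suc pos) (just pos) A≢
              in acc′ , trans e (cong (λ q → lastUnmatched i 0 u q acc′) (sym (+-suc pos (length A))))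
... | false = let acc′ , e = lastUnmatched-no-i+1 i A u (suc pos) acc A≢
              in acc′ , trans e (cong (λ q → lastUnmatched i 0 u q acc′) (sym (+-suc pos (length A))))

lastUnmatched-middle : ∀ i A B → All (_≢ suc i) A → All (_≢ i) B → lastUnmatched i 0 (A ++ i ∷ B) 0 nothing ≡ just (length A)
lastUnmatched-middle i A B A≢ B≢ with lastUnmatched-no-i+1 i A (i ∷ B) 0 nothing A≢
... | acc′ , e rewrite ≢⇒≡ᵇ≡false {i} {suc i} (<⇒≢ (n<1+n i)) | ≡⇒≡ᵇ≡true {i} refl =
  trans e (lastUnmatched-no-i i 0 B (suc (length A)) (just (length A)) B≢)

setAt-middle : ∀ A {x} B v → setAt (A ++ x ∷ B) (length A) v ≡ A ++ v ∷ B
setAt-middle []      B v = refl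
setAt-middle (y ∷ A) B v = cong (y ∷_) (setAt-middle A B v)

fWord-just⇒ : ∀ i u {u′} → fWord i u ≡ just u′ → ∃₂ λ A B → u ≡ A ++ i ∷ B × u′ ≡ A ++ suc i ∷ B
fWord-just⇒ i u e with lastUnmatched i 0 u 0 nothing in lu
fWord-just⇒ i u refl | just p with lastUnmatched-just i 0 u 0 nothing lu
... | inj₂ (A , B , refl , refl) = A , B , refl , setAt-middle A B (suc i)

fWord-acts : ∀ i A B → All (_≢ suc i) A → All (_≢ i) B → fWord i (A ++ i ∷ B) ≡ just (A ++ suc i ∷ B)
fWord-acts i A B A≢ B≢ rewrite lastUnmatched-middle i A B A≢ B≢ = cong just (setAt-middle A B (suc i))

fWord-map-raise : ∀ {a a′ : ℕ → ℕ} {i} W₁ j W₂ → a j ≡ i → a′ j ≡ suc i →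
                  (∀ {x} → x ∈ W₁ → a′ x ≡ a x × a x ≢ suc i) → (∀ {x} → x ∈ W₂ → a′ x ≡ a x × a x ≢ i) →
                  fWord i (map a (W₁ ++ j ∷ W₂)) ≡ just (map a′ (W₁ ++ j ∷ W₂))
fWord-map-raise {a} {a′} {i} W₁ j W₂ aj a′j before after = begin
  fWord i (map a (W₁ ++ j ∷ W₂))        ≡⟨ cong (fWord i) (trans (map-++ a W₁ (j ∷ W₂)) (cong (λ v → map a W₁ ++ v ∷ map a W₂) aj)) ⟩
  fWord i (map a W₁ ++ i ∷ map a W₂)    ≡⟨ fWord-acts i (map a W₁) (map a W₂) (All.map⁺ (All.tabulate (proj₂ ∘ before)))
                                                                             (All.map⁺ (All.tabulate (proj₂ ∘ after))) ⟩
  just (map a W₁ ++ suc i ∷ map a W₂)   ≡⟨ cong just (cong₂ (λ A B → A ++ suc i ∷ B) (unchanged-on W₁ before) (unchanged-on W₂ after)) ⟨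
  just (map a′ W₁ ++ suc i ∷ map a′ W₂) ≡⟨ cong just (trans (cong (λ v → map a′ W₁ ++ v ∷ map a′ W₂) (sym a′j)) (sym (map-++ a′ W₁ (j ∷ W₂)))) ⟩
  just (map a′ (W₁ ++ j ∷ W₂))          ∎
  where
  open ≡-Reasoning
  unchanged-on : ∀ {P : ℕ → Set} W → (∀ {x} → x ∈ W → a′ x ≡ a x × P x) → map a′ W ≡ map a W
  unchanged-on W same = map-cong-local (All.tabulate (proj₁ ∘ same))

map-raise⁻ : ∀ {a a′ : ℕ → ℕ} {i} w A B → map a w ≡ A ++ i ∷ B → map a′ w ≡ A ++ suc i ∷ B →
             ∃ λ j → j ∈ w × a j ≡ i × a′ j ≡ suc i × (∀ {x} → x ∈ w → x ≢ j → a′ x ≡ a x)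
map-raise⁻ {a} {a′} (j ∷ w) [] B eq eq′ with ∷-injective eq | ∷-injective eq′
... | aj , aw≡B | a′j , a′w≡B = j , here refl , aj , a′j , rest
  where
  rest : ∀ {x} → x ∈ j ∷ w → x ≢ j → a′ x ≡ a x
  rest (here refl)  x≢j = contradiction refl x≢j
  rest (there x∈w) _   = map≡map⇒≡ (trans a′w≡B (sym aw≡B)) x∈w
map-raise⁻ {a} {a′} (z ∷ w) (y ∷ A) B eq eq′ with ∷-injective eq | ∷-injective eq′
... | az , aw≡ | a′z , a′w≡ with map-raise⁻ w A B aw≡ a′w≡
...   | j , j∈w , aj , a′j , rest = j , there j∈w , aj , a′j , rest′
  where
  rest′ : ∀ {x} → x ∈ z ∷ w → x ≢ j → a′ x ≡ a x
  rest′ (here refl)  _   = trans a′z (sym az)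
  rest′ (there x∈w) x≢j = rest x∈w x≢j

fTab-just⇒ : ∀ i T {T′} → fTab i T ≡ just T′ → ∃ λ u′ → fWord i (rw T) ≡ just u′ × fromRw (shape T) u′ ≡ T′
fTab-just⇒ i T e with fWord i (rw T)
fTab-just⇒ i T refl | just u′ = u′ , refl , refl

fWord⇒fTab : ∀ i T {u′} → fWord i (rw T) ≡ just u′ → fTab i T ≡ just (fromRw (shape T) u′)
fWord⇒fTab i T e rewrite e = refl

-- Vertices of B(T_α) as fillings of a standard tableau

ColStrict-irrelevant : ∀ r r′ (p q : ColStrict r r′) → p ≡ q
ColStrict-irrelevant r       []       tt      tt      = refl
ColStrict-irrelevant (a ∷ r) (b ∷ r′) (p , ps) (q , qs) = cong₂ _,_ (≤-irrelevant p q) (ColStrict-irrelevant r r′ ps qs)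

ColsStrict-irrelevant : ∀ T (p q : ColsStrict T) → p ≡ q
ColsStrict-irrelevant []           tt       tt       = refl
ColsStrict-irrelevant (r ∷ [])     tt       tt       = refl
ColsStrict-irrelevant (r ∷ r′ ∷ T) (p , ps) (q , qs) = cong₂ _,_ (ColStrict-irrelevant r r′ p q) (ColsStrict-irrelevant (r′ ∷ T) ps qs)

SSYT-irrelevant : ∀ λ′ n T (p q : SSYT λ′ n T) → p ≡ q
SSYT-irrelevant λ′ n T (p₁ , p₂ , p₃ , p₄) (q₁ , q₂ , q₃ , q₄) =
  cong₂ _,_ (uip p₁ q₁) (cong₂ _,_ (All.irrelevant (All.irrelevant bounds-irrelevant) p₂ q₂)
    (cong₂ _,_ (All.irrelevant (Linked.irrelevant ≤-irrelevant) p₃ q₃) (ColsStrict-irrelevant T p₄ q₄)))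
  where
  bounds-irrelevant : ∀ {e} (p q : 1 ≤ e × e ≤ n) → p ≡ q
  bounds-irrelevant (p , p′) (q , q′) = cong₂ _,_ (≤-irrelevant p q) (≤-irrelevant p′ q′)

Vtx-≡ : ∀ {λ′ n S} {u v : Vtx λ′ n S} → proj₁ u ≡ proj₁ v → u ≡ v
Vtx-≡ {u = T , p , std≡} {v = .T , q , std≡′} refl = cong₂ (λ p e → T , p , e) (SSYT-irrelevant _ _ T p q) (uip std≡ std≡′)

descentᵇ : Tableau → ℕ → Bool
descentᵇ S x = rowOf S x <ᵇ rowOf S (suc x)

record Compatible (m : ℕ) (D : ℕ → Bool) (n : ℕ) (a : ℕ → ℕ) : Set where
  field
    bounded          : ∀ {x} → 1 ≤ x → x ≤ m → 1 ≤ a x × a x ≤ n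
    weakly-ascending : ∀ {x} → 1 ≤ x → suc x ≤ m → a x ≤ a (suc x)
    strict-descents  : ∀ {x} → 1 ≤ x → suc x ≤ m → D x ≡ true → a x < a (suc x)

record Raises (m i : ℕ) (a a′ : ℕ → ℕ) : Set where
  field
    cell      : ℕ
    1≤cell    : 1 ≤ cell
    cell≤m    : cell ≤ m
    before    : a cell ≡ i
    after     : a′ cell ≡ suc i
    unchanged : ∀ {x} → 1 ≤ x → x ≤ m → x ≢ cell → a′ x ≡ a x

module StandardTableau {S : Tableau} {m : ℕ} (S↭ : concat S ↭ [1‥ m ]) (S→ : All RowWeak S) (S↓ : ColsStrict S) where

  S! : Unique (concat S)
  S! = Unique-resp-↭ (↭-sym S↭) (Unique-[1‥] m)

  ∈S⁻ : ∀ {x} → x ∈ concat S → 1 ≤ x × x ≤ m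
  ∈S⁻ x∈ = ∈-[1‥]⁻ m (∈-resp-↭ S↭ x∈)

  ∈S⁺ : ∀ {x} → 1 ≤ x → x ≤ m → x ∈ concat S
  ∈S⁺ 1≤x x≤m = ∈-resp-↭ (↭-sym S↭) (∈-[1‥]⁺ m 1≤x x≤m)

  col : ℕ → ℕ
  col = colOf S

  index : ℕ → ℕ
  index x = indexOf x (rw S)

  Unique-rw : Unique (rw S)
  Unique-rw = Unique-resp-↭ (↭-sym (rw-↭ S)) S!

  ∈rw⁻ : ∀ {x} → x ∈ rw S → 1 ≤ x × x ≤ m
  ∈rw⁻ x∈ = ∈S⁻ (∈-resp-↭ (rw-↭ S) x∈)

  ∈rw⁺ : ∀ {x} → 1 ≤ x → x ≤ m → x ∈ rw S
  ∈rw⁺ 1≤x x≤m = ∈-resp-↭ (↭-sym (rw-↭ S)) (∈S⁺ 1≤x x≤m)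

  ascent-step : ∀ {x} → 1 ≤ x → suc x ≤ m → descentᵇ S x ≡ false → col x < col (suc x) × index x < index (suc x)
  ascent-step {x} 1≤x x<m no-descent with m≤n⇒m<n∨m≡n (<ᵇ≡false⇒≥ no-descent)
  ... | inj₂ same-row = col< , rw-precedes-same-row S S! x∈ x+1∈ same-row col<
    where
    x∈   = ∈S⁺ 1≤x (<⇒≤ x<m)
    x+1∈ = ∈S⁺ (s≤s z≤n) x<m
    col< : col x < col (suc x)
    col< = ≰⇒> λ col≤ → 1+n≰n (begin
      suc x                                         ≡⟨ entryAt-rowOf-colOf S x+1∈ ⟨
      entryAt S (rowOf S (suc x)) (col (suc x))     ≡⟨ cong (λ i → entryAt S i (col (suc x))) same-row ⟩
      entryAt S (rowOf S x) (col (suc x))           ≤⟨ nth-mono _ (RowWeak-rowAt S _ S→) col≤ (colOf-<-length S x∈) ⟩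
      entryAt S (rowOf S x) (col x)                 ≡⟨ entryAt-rowOf-colOf S x∈ ⟩
      x                                             ∎)
      where open ≤-Reasoning
  ... | inj₁ higher-row = col< , rw-precedes-higher-row S S! x∈ x+1∈ higher-row
    where
    x∈   = ∈S⁺ 1≤x (<⇒≤ x<m)
    x+1∈ = ∈S⁺ (s≤s z≤n) x<m
    col< : col x < col (suc x)
    col< = ≰⇒> λ col≤ → 1+n≰n (<⇒≤ (begin-strict
      suc x                                         ≡⟨ entryAt-rowOf-colOf S x+1∈ ⟨
      entryAt S (rowOf S (suc x)) (col (suc x))     <⟨ entryAt-<-southeast S S→ S↓ higher-row col≤ (colOf-<-length S x∈) ⟩
      entryAt S (rowOf S x) (col x)                 ≡⟨ entryAt-rowOf-colOf S x∈ ⟩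
      x                                             ∎))
      where open ≤-Reasoning

  module Filling {n a} (C : Compatible m (descentᵇ S) n a) where
    open Compatible C

    monotone : ∀ {x y} → 1 ≤ x → x ≤ y → y ≤ m → a x ≤ a y
    monotone {x} {y} 1≤x x≤y y≤m with m≤n⇒m<n∨m≡n x≤y
    ... | inj₂ refl = ≤-refl
    monotone {x} {suc y} 1≤x _ y<m | inj₁ (s≤s x≤y) =
      ≤-trans (monotone 1≤x x≤y (<⇒≤ y<m)) (weakly-ascending (≤-trans 1≤x x≤y) y<m)

    no-descent : ∀ {x} → 1 ≤ x → suc x ≤ m → a x ≡ a (suc x) → descentᵇ S x ≡ false
    no-descent {x} 1≤x x<m ax≡ with descentᵇ S x in d
    ... | true  = contradiction ax≡ (<⇒≢ (strict-descents 1≤x x<m d))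
    ... | false = refl

    equal-values-ascend : ∀ {x y} → 1 ≤ x → x < y → y ≤ m → a x ≡ a y → col x < col y × index x < index y
    equal-values-ascend {x} {suc y} 1≤x (s≤s x≤y) y<m ax≡ = go (m≤n⇒m<n∨m≡n x≤y)
      where
      1≤y = ≤-trans 1≤x x≤y
      ay≡ : a y ≡ a (suc y)
      ay≡ = ≤-antisym (weakly-ascending 1≤y y<m) (≤-trans (≤-reflexive (sym ax≡)) (monotone 1≤x x≤y (<⇒≤ y<m)))
      step : col y < col (suc y) × index y < index (suc y)
      step = ascent-step 1≤y y<m (no-descent 1≤y y<m ay≡)
      go : x < y ⊎ x ≡ y → col x < col (suc y) × index x < index (suc y)
      go (inj₂ x≡y) = subst (λ z → col z < col (suc y) × index z < index (suc y)) (sym x≡y) step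
      go (inj₁ x<y) with equal-values-ascend 1≤x x<y (<⇒≤ y<m) (trans ax≡ (sym ay≡))
      ... | col< , index< = <-trans col< (proj₁ step) , <-trans index< (proj₂ step)

    precedesᵇ-cells : ∀ {y x} → 1 ≤ y → y ≤ m → 1 ≤ x → x ≤ m → precedesᵇ a col y x ≡ (y <ᵇ x)
    precedesᵇ-cells {y} {x} 1≤y y≤m 1≤x x≤m with <-cmp y x
    ... | tri< y<x _ _ rewrite <⇒<ᵇ≡true y<x with m≤n⇒m<n∨m≡n (monotone 1≤y (<⇒≤ y<x) x≤m)
    ...   | inj₁ ay<ax = <⇒precedesᵇ a col ay<ax
    ...   | inj₂ ay≡ax = ≡∧<⇒precedesᵇ a col ay≡ax (proj₁ (equal-values-ascend 1≤y y<x x≤m ay≡ax))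
    precedesᵇ-cells {y} {x} 1≤y y≤m 1≤x x≤m | tri≈ _ refl _ rewrite ≥⇒<ᵇ≡false {y} ≤-refl = precedesᵇ-irrefl a col y
    precedesᵇ-cells {y} {x} 1≤y y≤m 1≤x x≤m | tri> _ _ x<y rewrite ≥⇒<ᵇ≡false (<⇒≤ x<y)
      with precedesᵇ a col y x in p
    ... | false = refl
    ... | true with precedesᵇ≡true⇒ a col p
    ...   | inj₁ ay<ax          = contradiction (monotone 1≤x (<⇒≤ x<y) y≤m) (<⇒≱ ay<ax)
    ...   | inj₂ (ay≡ax , cy<cx) = contradiction (proj₁ (equal-values-ascend 1≤x x<y y≤m (sym ay≡ax))) (<⇒≯ cy<cx)

    rank-cell : ∀ {x} → x ∈ concat S → suc (rank a S x) ≡ x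
    rank-cell {x} x∈ with ∈S⁻ x∈
    ... | 1≤x@(s≤s _) , x≤m = begin
      suc (countᵇ (λ y → precedesᵇ a col y x) (concat S))
        ≡⟨ cong suc (countᵇ-cong _ _ (concat S) (λ y∈ → let 1≤y , y≤m = ∈S⁻ y∈ in precedesᵇ-cells 1≤y y≤m 1≤x x≤m)) ⟩
      suc (countᵇ (_<ᵇ x) (concat S))
        ≡⟨ cong suc (countᵇ-↭ (_<ᵇ x) S↭) ⟩
      suc (countᵇ (_<ᵇ x) [1‥ m ])
        ≡⟨ countᵇ-<-upTo (suc m) (m≤n⇒m≤1+n x≤m) ⟩
      x ∎
      where open ≡-Reasoning

    std-relabel-self : std (relabel a S) ≡ S
    std-relabel-self = begin
      std (relabel a S)              ≡⟨ std-relabel a S S! ⟩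
      relabel (suc ∘ rank a S) S     ≡⟨ relabel-cong S rank-cell ⟩
      relabel id S                   ≡⟨ relabel-id S ⟩
      S ∎
      where open ≡-Reasoning

    SSYT-relabel : ∀ {λ′} → shape S ≡ λ′ → SSYT λ′ n (relabel a S)
    SSYT-relabel shape≡ = trans (shape-relabel a S) shape≡ , bounds , rows , columns
      where
      bounds : All (All (λ e → 1 ≤ e × e ≤ n)) (relabel a S)
      bounds = All.map⁺ (All.tabulate λ r∈ → All.map⁺ (All.tabulate λ x∈r →
                 let 1≤x , x≤m = ∈S⁻ (∈-concat⁺′ x∈r r∈) in bounded 1≤x x≤m))
      rows : All RowWeak (relabel a S)
      rows = All.map⁺ (All.tabulate λ {r} r∈ → RowWeak-map a r (All.lookup S→ r∈) λ x∈r y∈r x≤y →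
               monotone (proj₁ (∈S⁻ (∈-concat⁺′ x∈r r∈))) x≤y (proj₂ (∈S⁻ (∈-concat⁺′ y∈r r∈))))
      column< : ∀ i {k} → k < length (rowAt S (suc i)) → a (entryAt S i k) < a (entryAt S (suc i) k)
      column< i {k} k<₁ = ≰⇒> λ ay≤ax → <-irrefl (trans (proj₂ upper) (sym (proj₂ lower)))
        (proj₁ (equal-values-ascend 1≤x x<y y≤m (≤-antisym (monotone 1≤x (<⇒≤ x<y) y≤m) ay≤ax)))
        where
        i+1< = rowAt-nonempty⇒< S (suc i) (≤-trans (s≤s z≤n) k<₁)
        k<₀  = ≤-trans k<₁ (length-rowAt-antitone S S↓ (n≤1+n i))
        x<y  = entryAt-<-below S S↓ (n<1+n i) k<₁
        upper = rowOf-colOf-entryAt S S! (<-trans (n<1+n i) i+1<) k<₀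
        lower = rowOf-colOf-entryAt S S! i+1< k<₁
        1≤x  = proj₁ (∈S⁻ (entryAt-∈ S (<-trans (n<1+n i) i+1<) k<₀))
        y≤m  = proj₂ (∈S⁻ (entryAt-∈ S i+1< k<₁))
      columns : ColsStrict (relabel a S)
      columns = ColsStrict-relabel a S S↓ column<

  module Standardizes {λ′ n a} (T-ssyt : SSYT λ′ n (relabel a S)) (std≡S : std (relabel a S) ≡ S) where
    private
      T→ = proj₁ (proj₂ (proj₂ T-ssyt))
      T↓ = proj₂ (proj₂ (proj₂ T-ssyt))

    bounded : ∀ {x} → 1 ≤ x → x ≤ m → 1 ≤ a x × a x ≤ n
    bounded 1≤x x≤m = All.lookup (All.concat⁺ (proj₁ (proj₂ T-ssyt)))
                        (subst (a _ ∈_) (sym (concat-map S)) (∈-map⁺ a (∈S⁺ 1≤x x≤m)))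

    rank-cell : ∀ {x} → x ∈ concat S → suc (rank a S x) ≡ x
    rank-cell = relabel≡⇒fixed S (trans (sym (std-relabel a S S!)) std≡S)

    precedes⇒< : ∀ {y x} → 1 ≤ y → y ≤ m → 1 ≤ x → x ≤ m → precedesᵇ a col y x ≡ true → y < x
    precedes⇒< {y} {x} 1≤y y≤m 1≤x x≤m yx = begin-strict
      y                    ≡⟨ rank-cell (∈S⁺ 1≤y y≤m) ⟨
      suc (rank a S y)     <⟨ s≤s (countᵇ-mono-< _ _ (concat S) (λ _ zy → precedesᵇ-trans a col zy yx)
                                    (∈S⁺ 1≤y y≤m) (precedesᵇ-irrefl a col y) yx) ⟩
      suc (rank a S x)     ≡⟨ rank-cell (∈S⁺ 1≤x x≤m) ⟩
      x                    ∎
      where open ≤-Reasoning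

    weakly-ascending : ∀ {x} → 1 ≤ x → suc x ≤ m → a x ≤ a (suc x)
    weakly-ascending {x} 1≤x x<m = ≮⇒≥ λ ax+1<ax →
      <-asym (n<1+n x) (precedes⇒< (s≤s z≤n) x<m 1≤x (<⇒≤ x<m) (<⇒precedesᵇ a col ax+1<ax))

    strict-descents : ∀ {x} → 1 ≤ x → suc x ≤ m → descentᵇ S x ≡ true → a x < a (suc x)
    strict-descents {x} 1≤x x<m descent with m≤n⇒m<n∨m≡n (weakly-ascending 1≤x x<m)
    ... | inj₁ ax<ax+1 = ax<ax+1
    ... | inj₂ ax≡ax+1 = begin-strict
      a x                                                          ≡⟨ cong a (entryAt-rowOf-colOf S x∈) ⟨
      a (entryAt S (rowOf S x) (col x))                            ≡⟨ entryAt-relabel a S (colOf-<-length S x∈) ⟨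
      entryAt (relabel a S) (rowOf S x) (col x)
        <⟨ entryAt-<-southeast (relabel a S) T→ T↓ (<ᵇ≡true⇒< descent) col≤
             (subst (col (suc x) <_) (sym (length-rowAt-relabel a S _)) (colOf-<-length S x+1∈)) ⟩
      entryAt (relabel a S) (rowOf S (suc x)) (col (suc x))        ≡⟨ entryAt-relabel a S (colOf-<-length S x+1∈) ⟩
      a (entryAt S (rowOf S (suc x)) (col (suc x)))                ≡⟨ cong a (entryAt-rowOf-colOf S x+1∈) ⟩
      a (suc x)                                                    ∎
      where
      open ≤-Reasoning
      x∈   = ∈S⁺ 1≤x (<⇒≤ x<m)
      x+1∈ = ∈S⁺ (s≤s z≤n) x<m
      col≤ : col x ≤ col (suc x)
      col≤ = ≮⇒≥ λ col< → <-asym (n<1+n x)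
               (precedes⇒< (s≤s z≤n) x<m 1≤x (<⇒≤ x<m) (≡∧<⇒precedesᵇ a col (sym ax≡ax+1) col<))

  compatible : ∀ {λ′ n a} → SSYT λ′ n (relabel a S) → std (relabel a S) ≡ S → Compatible m (descentᵇ S) n a
  compatible T-ssyt std≡S = record { bounded = bounded ; weakly-ascending = weakly-ascending ; strict-descents = strict-descents }
    where open Standardizes T-ssyt std≡S

  raises-of-edge : ∀ {i a a′} → fTab i (relabel a S) ≡ just (relabel a′ S) → Raises m i a a′
  raises-of-edge {i} {a} {a′} e with fTab-just⇒ i (relabel a S) e
  ... | u′ , fw , fromRw≡ with fWord-just⇒ i (map a (rw S)) (subst (λ u → fWord i u ≡ just u′) (rw-relabel a S) fw)
  ... | A , B , aw≡ , refl with map-raise⁻ (rw S) A B aw≡ a′w≡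
    where
    a′w≡ : map a′ (rw S) ≡ A ++ suc i ∷ B
    a′w≡ = begin
      map a′ (rw S)                                          ≡⟨ rw-relabel a′ S ⟨
      rw (relabel a′ S)                                      ≡⟨ cong rw fromRw≡ ⟨
      rw (fromRw (shape (relabel a S)) (A ++ suc i ∷ B))     ≡⟨ rw-fromRw (shape (relabel a S)) (A ++ suc i ∷ B) length≡ ⟩
      A ++ suc i ∷ B                                         ∎
      where
      open ≡-Reasoning
      length≡ : length (A ++ suc i ∷ B) ≡ sum (shape (relabel a S))
      length≡ = begin
        length (A ++ suc i ∷ B)      ≡⟨ trans (length-++ A) (sym (length-++ A)) ⟩
        length (A ++ i ∷ B)          ≡⟨ cong length aw≡ ⟨
        length (map a (rw S))        ≡⟨ cong length (rw-relabel a S) ⟨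
        length (rw (relabel a S))    ≡⟨ length-rw (relabel a S) ⟩
        sum (shape (relabel a S))    ∎
  ... | j , j∈ , aj , a′j , rest = record
    { cell = j ; 1≤cell = proj₁ (∈rw⁻ j∈) ; cell≤m = proj₂ (∈rw⁻ j∈) ; before = aj ; after = a′j
    ; unchanged = λ 1≤x x≤m → rest (∈rw⁺ 1≤x x≤m) }

  module Raising {n i a a′} (C : Compatible m (descentᵇ S) n a) (C′ : Compatible m (descentᵇ S) n a′)
                  (R : Raises m i a a′) where
    open Raises R renaming (cell to j)
    open Filling C using (monotone; equal-values-ascend)
    open Filling C′ using () renaming (no-descent to no-descent′)
    open Compatible C′ using () renaming (weakly-ascending to weakly-ascending′)

    a[j+1]>i : suc j ≤ m → suc i ≤ a (suc j)
    a[j+1]>i j<m = begin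
      suc i        ≡⟨ after ⟨
      a′ j         ≤⟨ weakly-ascending′ 1≤cell j<m ⟩
      a′ (suc j)   ≡⟨ unchanged (s≤s z≤n) j<m 1+n≢n ⟩
      a (suc j)    ∎
      where open ≤-Reasoning

    read-after-j : ∀ {x} → 1 ≤ x → x ≤ m → a x ≡ suc i → index j < index x
    read-after-j {x} 1≤x x≤m ax≡ = from-step (m≤n⇒m<n∨m≡n j<x)
      where
      j<x : j < x
      j<x = ≰⇒> λ x≤j → 1+n≰n (≤-trans (≤-reflexive (sym ax≡)) (≤-trans (monotone 1≤x x≤j cell≤m) (≤-reflexive before)))
      j<m = ≤-trans j<x x≤m
      a[j+1]≡ : a (suc j) ≡ suc i
      a[j+1]≡ = ≤-antisym (≤-trans (monotone (s≤s z≤n) j<x x≤m) (≤-reflexive ax≡)) (a[j+1]>i j<m)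
      step : col j < col (suc j) × index j < index (suc j)
      step = ascent-step 1≤cell j<m (no-descent′ 1≤cell j<m (trans after (sym (trans (unchanged (s≤s z≤n) j<m 1+n≢n) a[j+1]≡))))
      from-step : suc j < x ⊎ suc j ≡ x → index j < index x
      from-step (inj₂ j+1≡x) = subst (λ z → index j < index z) j+1≡x (proj₂ step)
      from-step (inj₁ j+1<x) =
        <-trans (proj₂ step) (proj₂ (equal-values-ascend (s≤s z≤n) j+1<x x≤m (trans a[j+1]≡ (sym ax≡))))

    read-before-j : ∀ {x} → 1 ≤ x → x ≤ m → x ≢ j → a x ≡ i → index x < index j
    read-before-j {x} 1≤x x≤m x≢j ax≡ = proj₂ (equal-values-ascend 1≤x x<j cell≤m (trans ax≡ (sym before)))
      where
      x<j : x < j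
      x<j with <-cmp x j
      ... | tri< x<j _ _ = x<j
      ... | tri≈ _ x≡j _ = contradiction x≡j x≢j
      ... | tri> _ _ j<x = contradiction (≤-trans (a[j+1]>i (≤-trans j<x x≤m)) (monotone (s≤s z≤n) j<x x≤m))
                                         (λ i<ax → 1+n≰n (≤-trans i<ax (≤-reflexive ax≡)))

    module _ {W₁ W₂} (w≡ : rw S ≡ W₁ ++ j ∷ W₂) where
      W! : Unique (W₁ ++ j ∷ W₂)
      W! = subst Unique w≡ Unique-rw

      in-range : ∀ {x} → x ∈ W₁ ++ j ∷ W₂ → 1 ≤ x × x ≤ m
      in-range x∈ = ∈rw⁻ (subst (_ ∈_) (sym w≡) x∈)

      index-in : ∀ x → index x ≡ indexOf x (W₁ ++ j ∷ W₂)
      index-in x = cong (indexOf x) w≡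

      index-j : index j ≡ length W₁
      index-j = trans (index-in j) (indexOf-middle W₁ W₂ (λ j∈W₁ → Unique-++⇒∉ W₁ W! j∈W₁ (here refl)))

      x≢j : ∀ {W x} → x ∈ W → j ∉ W → x ≢ j
      x≢j x∈W j∉W x≡j = j∉W (subst (_∈ _) x≡j x∈W)

      before-j : ∀ {x} → x ∈ W₁ → a′ x ≡ a x × a x ≢ suc i
      before-j {x} x∈W₁ = unchanged 1≤x x≤m (x≢j x∈W₁ (λ j∈W₁ → Unique-++⇒∉ W₁ W! j∈W₁ (here refl))) , λ ax≡ →
        <-asym (read-after-j 1≤x x≤m ax≡) (subst₂ _<_ (sym (index-in x)) (sym index-j) (indexOf-prefix W₁ (j ∷ W₂) x∈W₁))
        where
        1≤x = proj₁ (in-range (∈-++⁺ˡ x∈W₁))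
        x≤m = proj₂ (in-range (∈-++⁺ˡ x∈W₁))

      after-j : ∀ {x} → x ∈ W₂ → a′ x ≡ a x × a x ≢ i
      after-j {x} x∈W₂ = unchanged 1≤x x≤m x≢j′ , λ ax≡ →
        <-asym (read-before-j 1≤x x≤m x≢j′ ax≡)
               (subst₂ _<_ (sym index-j) (sym (index-in x)) (indexOf-suffix W₁ W₂ (λ x∈W₁ → Unique-++⇒∉ W₁ W! x∈W₁ (there x∈W₂)) x≢j′))
        where
        1≤x  = proj₁ (in-range (∈-++⁺ʳ W₁ (there x∈W₂)))
        x≤m  = proj₂ (in-range (∈-++⁺ʳ W₁ (there x∈W₂)))
        x≢j′ = x≢j x∈W₂ (Unique[x∷xs]⇒x∉xs (Unique-++⁻ʳ W₁ W!))

  edge-of-raises : ∀ {n i a a′} → Compatible m (descentᵇ S) n a → Compatible m (descentᵇ S) n a′ →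
                   Raises m i a a′ → fTab i (relabel a S) ≡ just (relabel a′ S)
  edge-of-raises {n} {i} {a} {a′} C C′ R with ∈-∃++ (∈rw⁺ (Raises.1≤cell R) (Raises.cell≤m R))
  ... | W₁ , W₂ , w≡ = trans (fWord⇒fTab i (relabel a S) f-word) (cong just (fromRw-relabel a a′ S))
    where
    open Raises R renaming (cell to j)
    open Raising C C′ R

    word-of : ∀ b → rw (relabel b S) ≡ map b (W₁ ++ j ∷ W₂)
    word-of b = trans (rw-relabel b S) (cong (map b) w≡)

    f-word : fWord i (rw (relabel a S)) ≡ just (rw (relabel a′ S))
    f-word = subst₂ (λ u u′ → fWord i u ≡ just u′) (sym (word-of a)) (sym (word-of a′))
                    (fWord-map-raise W₁ j W₂ before after (before-j w≡) (after-j w≡))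

module Vertices {λ′ S} (S-std : Standard λ′ S) (n : ℕ) where

  private
    S-ssyt = proj₁ S-std

  open StandardTableau (proj₂ S-std) (proj₁ (proj₂ (proj₂ S-ssyt))) (proj₂ (proj₂ (proj₂ S-ssyt))) public

  label : Vtx λ′ n S → ℕ → ℕ
  label u = labelling S (proj₁ u)

  relabel-label : ∀ u → relabel (label u) S ≡ proj₁ u
  relabel-label (T , T-ssyt , _) = relabel-labelling S T S! (trans (proj₁ S-ssyt) (sym (proj₁ T-ssyt)))

  label-compatible : ∀ u → Compatible (sum λ′) (descentᵇ S) n (label u)
  label-compatible u@(_ , T-ssyt , std≡S) =
    compatible (subst (SSYT λ′ n) (sym (relabel-label u)) T-ssyt) (trans (cong std (relabel-label u)) std≡S)

  vertex : ∀ {a} → Compatible (sum λ′) (descentᵇ S) n a → Vtx λ′ n S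
  vertex {a} C = relabel a S , Filling.SSYT-relabel C (proj₁ S-ssyt) , Filling.std-relabel-self C

  vertex-label : ∀ {a} (C : Compatible (sum λ′) (descentᵇ S) n a) u → (∀ {x} → x ∈ concat S → a x ≡ label u x) →
                 vertex C ≡ u
  vertex-label C u a≗label = Vtx-≡ (trans (relabel-cong S a≗label) (relabel-label u))

-- Descents are determined by the descent composition

Ascending : ℕ → List ℕ → ℕ → Set
Ascending p []       M = p ≤ M
Ascending p (d ∷ ds) M = p < d × Ascending d ds M

filterᵇ-applyUpTo-ascending : ∀ f g {p} k {M} → p ≤ M → p < g 0 → (∀ i → g i < g (suc i)) →
                              (∀ {i} → i < k → g i ≤ M) → Ascending p (filterᵇ f (applyUpTo g k)) M
filterᵇ-applyUpTo-ascending f g zero    p≤M _   _     _     = p≤M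
filterᵇ-applyUpTo-ascending f g (suc k) p≤M p<g₀ g↑ g≤M with f (g 0)
... | true  = p<g₀ , filterᵇ-applyUpTo-ascending f (g ∘ suc) k (g≤M (s≤s z≤n)) (g↑ 0) (g↑ ∘ suc) (g≤M ∘ s≤s)
... | false = filterᵇ-applyUpTo-ascending f (g ∘ suc) k p≤M (<-trans p<g₀ (g↑ 0)) (g↑ ∘ suc) (g≤M ∘ s≤s)

descents-ascending : ∀ S → Ascending 0 (descents S) (length (concat S))
descents-ascending S = filterᵇ-applyUpTo-ascending _ suc (length (concat S) ∸ 1) z≤n (s≤s z≤n) (λ i → n<1+n (suc i))
  (λ i<M∸1 → ≤-trans i<M∸1 (m∸n≤m (length (concat S)) 1))

diffs-injective : ∀ {p ds ds′ M M′} → Ascending p ds M → Ascending p ds′ M′ → diffs p ds M ≡ diffs p ds′ M′ →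
                  ds ≡ ds′ × M ≡ M′
diffs-injective {p} {[]}     {[]}      p≤M p≤M′ eq =
  refl , trans (sym (m∸n+n≡m p≤M)) (trans (cong (_+ p) (proj₁ (∷-injective eq))) (m∸n+n≡m p≤M′))
diffs-injective {p} {[]}     {d ∷ []}     _ _ eq with () ← proj₂ (∷-injective eq)
diffs-injective {p} {[]}     {d ∷ _ ∷ _}  _ _ eq with () ← proj₂ (∷-injective eq)
diffs-injective {p} {d ∷ []}    {[]}      _ _ eq with () ← proj₂ (∷-injective eq)
diffs-injective {p} {d ∷ _ ∷ _} {[]}      _ _ eq with () ← proj₂ (∷-injective eq)
diffs-injective {p} {d ∷ ds} {d′ ∷ ds′} (p<d , asc) (p<d′ , asc′) eq with ∷-injective eq
... | d∸p≡ , rest with trans (sym (m∸n+n≡m (<⇒≤ p<d))) (trans (cong (_+ p) d∸p≡) (m∸n+n≡m (<⇒≤ p<d′)))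
...   | refl = let ds≡ , M≡ = diffs-injective asc asc′ rest in cong (d ∷_) ds≡ , M≡

DesComp≡⇒descentᵇ≡ : ∀ S₁ S₂ → DesComp S₁ ≡ DesComp S₂ →
  length (concat S₁) ≡ length (concat S₂) × (∀ {x} → 1 ≤ x → suc x ≤ length (concat S₁) → descentᵇ S₁ x ≡ descentᵇ S₂ x)
DesComp≡⇒descentᵇ≡ S₁ S₂ eq with diffs-injective (descents-ascending S₁) (descents-ascending S₂) eq
... | descents≡ , size≡ = size≡ , λ {x} 1≤x x<M → filterᵇ-≡⇒≡ (descentᵇ S₁) (descentᵇ S₂)
      (trans descents≡ (cong (λ M → filterᵇ (descentᵇ S₂) [1‥ M ∸ 1 ]) (sym size≡)))
      (∈-[1‥]⁺ (length (concat S₁) ∸ 1) 1≤x (∸-monoˡ-≤ 1 x<M))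

length-concat-standard : ∀ {λ′ S} → Standard λ′ S → length (concat S) ≡ sum λ′
length-concat-standard {λ′} std = trans (↭-length (proj₂ std)) (length-applyUpTo suc (sum λ′))

Compatible-transfer : ∀ {m₁ m₂ D₁ D₂ n a} → m₁ ≡ m₂ → (∀ {x} → 1 ≤ x → suc x ≤ m₁ → D₁ x ≡ D₂ x) →
                      Compatible m₁ D₁ n a → Compatible m₂ D₂ n a
Compatible-transfer refl D≡ C = record
  { bounded          = bounded
  ; weakly-ascending = weakly-ascending
  ; strict-descents  = λ 1≤x x<m d → strict-descents 1≤x x<m (trans (D≡ 1≤x x<m) d)
  }
  where open Compatible C

crystal-≅ : ∀ {λ₁ λ₂ S₁ S₂} n → Standard λ₁ S₁ → Standard λ₂ S₂ → sum λ₁ ≡ sum λ₂ →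
            (∀ {x} → 1 ≤ x → suc x ≤ sum λ₁ → descentᵇ S₁ x ≡ descentᵇ S₂ x) →
            Σ (Vtx λ₁ n S₁ ↔ Vtx λ₂ n S₂) λ φ →
              ∀ i (u v : Vtx λ₁ n S₁) → Edge i u v ⇔ Edge i (Inverse.to φ u) (Inverse.to φ v)
crystal-≅ {λ₁} {λ₂} {S₁} {S₂} n std₁ std₂ size≡ descents≡ = mk↔ₛ′ to from to-from from-to , edges
  where
  module V₁ = Vertices std₁ n
  module V₂ = Vertices std₂ n

  descents≡′ : ∀ {x} → 1 ≤ x → suc x ≤ sum λ₂ → descentᵇ S₂ x ≡ descentᵇ S₁ x
  descents≡′ 1≤x x<m = sym (descents≡ 1≤x (subst (suc _ ≤_) (sym size≡) x<m))

  to : Vtx λ₁ n S₁ → Vtx λ₂ n S₂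
  to u = V₂.vertex (Compatible-transfer size≡ descents≡ (V₁.label-compatible u))

  from : Vtx λ₂ n S₂ → Vtx λ₁ n S₁
  from v = V₁.vertex (Compatible-transfer (sym size≡) descents≡′ (V₂.label-compatible v))

  cell₁⇒₂ : ∀ {x} → x ∈ concat S₁ → x ∈ concat S₂
  cell₁⇒₂ x∈ = let 1≤x , x≤m = V₁.∈S⁻ x∈ in V₂.∈S⁺ 1≤x (subst (_ ≤_) size≡ x≤m)

  cell₂⇒₁ : ∀ {x} → x ∈ concat S₂ → x ∈ concat S₁
  cell₂⇒₁ x∈ = let 1≤x , x≤m = V₂.∈S⁻ x∈ in V₁.∈S⁺ 1≤x (subst (_ ≤_) (sym size≡) x≤m)

  to-from : ∀ v → to (from v) ≡ v
  to-from v = V₂.vertex-label _ v λ x∈ → labelling-relabel (V₂.label v) S₁ (cell₂⇒₁ x∈)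

  from-to : ∀ u → from (to u) ≡ u
  from-to u = V₁.vertex-label _ u λ x∈ → labelling-relabel (V₁.label u) S₂ (cell₁⇒₂ x∈)

  edges : ∀ i (u v : Vtx λ₁ n S₁) → Edge i u v ⇔ Edge i (to u) (to v)
  edges i u v = mk⇔
    (λ e → V₂.edge-of-raises C₂u C₂v (subst (λ m → Raises m i _ _) size≡ (V₁.raises-of-edge (relabelled e))))
    (λ e → subst₂ (λ T T′ → fTab i T ≡ just T′) (V₁.relabel-label u) (V₁.relabel-label v)
             (V₁.edge-of-raises (V₁.label-compatible u) (V₁.label-compatible v)
               (subst (λ m → Raises m i _ _) (sym size≡) (V₂.raises-of-edge e))))
    where
    C₂u = Compatible-transfer size≡ descents≡ (V₁.label-compatible u)
    C₂v = Compatible-transfer size≡ descents≡ (V₁.label-compatible v)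
    relabelled : Edge i u v → fTab i (relabel (V₁.label u) S₁) ≡ just (relabel (V₁.label v) S₁)
    relabelled = subst₂ (λ T T′ → fTab i T ≡ just T′) (sym (V₁.relabel-label u)) (sym (V₁.relabel-label v))

mainTheorem4 : (n : ℕ) → 1 ≤ n
    → (α : List ℕ) → IsComposition α → length α ≤ n
    → (λ₁ λ₂ : List ℕ) → IsPartition λ₁ → IsPartition λ₂
    → (S₁ S₂ : Tableau) → Standard λ₁ S₁ → Standard λ₂ S₂
    → DesComp S₁ ≡ α → DesComp S₂ ≡ α
    → Σ (Vtx λ₁ n S₁ ↔ Vtx λ₂ n S₂) (λ φ →
        (i : ℕ) → 1 ≤ i → i < n → (u v : Vtx λ₁ n S₁) →
          Edge i u v ⇔ Edge i (Inverse.to φ u) (Inverse.to φ v))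
mainTheorem4 n _ α _ _ λ₁ λ₂ _ _ S₁ S₂ std₁ std₂ des₁ des₂ =
  let φ , edges = crystal-≅ n std₁ std₂ size≡ descents≡ in φ , λ i _ _ → edges i
  where
  size₁ = length-concat-standard std₁
  same-descents = DesComp≡⇒descentᵇ≡ S₁ S₂ (trans des₁ (sym des₂))
  size≡ : sum λ₁ ≡ sum λ₂
  size≡ = trans (sym size₁) (trans (proj₁ same-descents) (length-concat-standard std₂))
  descents≡ : ∀ {x} → 1 ≤ x → suc x ≤ sum λ₁ → descentᵇ S₁ x ≡ descentᵇ S₂ x
  descents≡ 1≤x x<m = proj₂ same-descents 1≤x (subst (suc _ ≤_) (sym size₁) x<m)
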